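{- Let $\mathcal{C}$ be a collection of $\mathbf{S}$-structures over a schema $\mathbf{S}$ that is finitely axiomatizable by $(n,m,\ell)$-dexrs, for integers $n,m\geq0$ with $n+m>0$ and $\ell>0$. Let $\ell'=\ell\cdot|\mathbf{S}|\cdot(n+m+1)^{m\cdot\mathrm{ar}(\mathbf{S})}$, where $\mathrm{ar}(\mathbf{S})$ is the maximum arity of a relation symbol in $\mathbf{S}$. The following are equivalent: (1) $\mathcal{C}$ is finitely axiomatizable by linear dexrs; (2) $\mathcal{C}$ is linear-diagrammatically $(n,m,\ell')$-compatible.
   Context: A schema $\mathbf{S}$ is a finite set of relation symbols with positive arities. An $\mathbf{S}$-structure $I$ has a domain $\mathrm{dom}(I)$ contained in a fixed countably infinite set of constants and relations $R^I\subseteq\mathrm{dom}(I)^{\mathrm{ar}(R)}$; $\mathrm{facts}(I)$ is its set of facts, $\mathrm{adom}(I)$ the set of elements occurring in facts; $J\subseteq I$ means $\mathrm{facts}(J)\subseteq\mathrm{facts}(I)$. Collections of structures are closed under isomorphism. A disjunctive existential rule (dexr) over $\mathbf{S}$ is a constant-free sentence $\forall\bar x\forall\bar y\,(\phi(\bar x,\bar y)\rightarrow\bigvee_{i=1}^k\exists\bar z_i\,\psi_i(\bar x_i,\bar z_i))$ with $k>0$, $\phi$ a (possibly empty) conjunction of atoms over $\mathbf{S}$ with variable arguments, each $\psi_i$ a non-empty conjunction of atoms, the variables of $\bar x_i$ among $\bar x$, each variable of $\bar x$ in some $\bar x_i$; usual semantics. It is an $(n,m,\ell)$-dexr if its body mentions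 at most $n$ variables, each head disjunct has at most $m$ existentially quantified variables, and it has at most $\ell$ head disjuncts; it is linear if its body has at most one atom. $\mathcal{C}$ is finitely axiomatizable by a class of dexrs if there is a finite set $\Sigma$ of dexrs over $\mathbf{S}$ from that class with $I\in\mathcal{C}$ iff $I\models\Sigma$ for every $\mathbf{S}$-structure $I$. Diagrams: sentences may mention constants, interpreted as themselves. For an $\mathbf{S}$-structure $I$, a finite $K\subseteq I$ with $\mathrm{dom}(K)=\mathrm{adom}(K)$, and $m\geq0$: with distinct variables $y_1,\dots,y_m$, $C_{K,m}$ is the set of conjunctions of atoms $R(\bar u)$, $R\in\mathbf{S}$, $\bar u\in(\mathrm{dom}(K)\cup\{y_1,\dots,y_m\})^{\mathrm{ar}(R)}$; $N^I_{K,m}=\{\gamma(\bar y)\in C_{K,m}:I\not\models\exists\bar y\,\gamma(\bar y)\}$. For $G\subseteq N^I_{K,m}$ with $|G|\leq\ell$, $\Delta^I_{K,G}=\bigwedge_{\alpha\in\mathrm{facts}(K)}\alpha\wedge\bigwedge_{c\neq d\in\mathrm{dom}(K)}\neg(c=d)\wedge\bigwedge_{\gamma\in G}\neg\exists\bar y\,\gamma(\bar y)$ is an $(m,\ell)$-diagram of $K$ relative to $I$. A structure $K$ is linear if $|\mathrm{facts}(K)|\leq1$. $\mathcal{C}$ is linear-diagrammatically $(n,m,\ell)$-compatible with $I$ if for every linear $K\subseteq I$ with $\mathrm{dom}(K)=\mathrm{adom}(K)$ and $|\mathrm{dom}(K)|\leq n$, and every $(m,\ell)$-diagram $\Delta$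 of $K$ relative to $I$, some $J\in\mathcal{C}$ satisfies $\Delta$; $\mathcal{C}$ is linear-diagrammatically $(n,m,\ell)$-compatible if every $\mathbf{S}$-structure $I$ with which it is linear-diagrammatically $(n,m,\ell)$-compatible belongs to $\mathcal{C}$. -}

module Defs where

open import Level using (0ℓ)
open import Data.Nat using (ℕ; zero; suc; _+_; _*_; _^_; _≤_; _⊔_)
open import Data.Fin using (Fin)
open import Data.Vec using (Vec; lookup; map)
open import Data.List using (List; []; _∷_; length; allFin; foldr)
import Data.List as List
open import Data.List.Relation.Unary.All using (All)
open import Data.List.Relation.Unary.Any using (Any)
open import Data.List.Membership.Propositional using (_∈_)
open import Data.Product using (Σ; ∃; ∃-syntax; _×_; _,_)
open import Data.Sum using (_⊎_; inj₁; inj₂)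
open import Data.Empty using (⊥)
open import Relation.Nullary using (¬_)
open import Relation.Binary.PropositionalEquality using (_≡_)

record Schema : Set where
  field
    size  : ℕ
    ar    : Fin size → ℕ
    ar-pos : ∀ R → 1 ≤ ar R

open Schema public

maxAr : Schema → ℕ
maxAr S = foldr (λ R acc → ar S R ⊔ acc) 0 (allFin (size S))

-- Constants are the natural numbers (a fixed countably
-- infinite set).

Const : Set
Const = ℕ

record Structure (S : Schema) : Set₁ where
  field
    dom     : Const → Set
    rel     : (R : Fin (size S)) → Vec Const (ar S R) → Set
    rel-dom : ∀ R t → rel R t → ∀ i → dom (lookup t i)

open Structure public

Fact : Schema → Set
Fact S = Σ (Fin (size S)) λ R → Vec Const (ar S R)

_⊆ₛ_ : {S : Schema} → Structure S → Structure S → Set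
J ⊆ₛ I = ∀ R t → rel J R t → rel I R t

adom : {S : Schema} → Structure S → Const → Set
adom {S} I c = Σ (Fin (size S)) λ R → Σ (Vec Const (ar S R)) λ t →
  rel I R t × ∃[ i ] (lookup t i ≡ c)

-- dom(K) = adom(K)  (adom ⊆ dom holds by rel-dom)
DomIsAdom : {S : Schema} → Structure S → Set
DomIsAdom K = ∀ c → dom K c → adom K c

DomCard≤ : {S : Schema} → Structure S → ℕ → Set
DomCard≤ K n = Σ (List Const) λ xs → length xs ≤ n × (∀ c → dom K c → c ∈ xs)

LinearStr : {S : Schema} → Structure S → Set
LinearStr {S} K = ∀ {R R' t t'} → rel K R t → rel K R' t' →
  _≡_ {A = Fact S} (R , t) (R' , t')

record Iso {S : Schema} (I J : Structure S) : Set where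
  field
    f     : Const → Const
    g     : Const → Const
    f-dom : ∀ c → dom I c → dom J (f c)
    g-dom : ∀ c → dom J c → dom I (g c)
    gf    : ∀ c → dom I c → g (f c) ≡ c
    fg    : ∀ c → dom J c → f (g c) ≡ c
    f-rel : ∀ R t → rel I R t → rel J R (map f t)
    g-rel : ∀ R t → rel J R t → rel I R (map g t)

Collection : Schema → Set₂
Collection S = Structure S → Set₁

ClosedUnderIso : {S : Schema} → Collection S → Set₁
ClosedUnderIso C = ∀ I J → Iso I J → C I → C J

record Atom (S : Schema) (T : Set) : Set where
  constructor atom
  field
    sym  : Fin (size S)
    args : Vec T (ar S sym)

HoldsAtom : {S : Schema} {T : Set} → Structure S → (T → Const) → Atom S T → Set
HoldsAtom I ν (atom R u) = rel I R (map ν u)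

InDom : {S : Schema} {k : ℕ} → Structure S → (Fin k → Const) → Set
InDom I h = ∀ i → dom I (h i)

-- The universally quantified variables (x̄ȳ) are Fin v; the body is a
-- (possibly empty) conjunction of atoms over them, and every universal
-- variable occurs in the body.  The frontier x̄ is the set
-- of universal variables occurring in the head, so each x in some x̄_i.

record Disjunct (S : Schema) (v : ℕ) : Set where
  constructor disj
  field
    nex   : ℕ
    atoms : List (Atom S (Fin v ⊎ Fin nex))

record Dexr (S : Schema) : Set where
  constructor dexr
  field
    nvars : ℕ
    body  : List (Atom S (Fin nvars))
    head  : List (Disjunct S nvars)

open Disjunct public
open Dexr public

OccursIn : {S : Schema} {T : Set} → T → List (Atom S T) → Set
OccursIn x as = Any (λ a → ∃[ i ] (lookup (Atom.args a) i ≡ x)) as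

WF : {S : Schema} → Dexr S → Set
WF (dexr v b h) =
  (∀ (x : Fin v) → OccursIn x b) ×
  (1 ≤ length h) ×
  All (λ d → 1 ≤ length (atoms d)) h

IsNMLDexr : {S : Schema} → ℕ → ℕ → ℕ → Dexr S → Set
IsNMLDexr n m ℓ σ =
  WF σ × (nvars σ ≤ n) × All (λ d → nex d ≤ m) (head σ) × (length (head σ) ≤ ℓ)

IsLinearDexr : {S : Schema} → Dexr S → Set
IsLinearDexr σ = WF σ × (length (body σ) ≤ 1)

[_,_] : {v e : ℕ} → (Fin v → Const) → (Fin e → Const) → Fin v ⊎ Fin e → Const
[ h , g ] (inj₁ x) = h x
[ h , g ] (inj₂ z) = g z

SatDisjunct : {S : Schema} {v : ℕ} → Structure S → (Fin v → Const) → Disjunct S v → Set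
SatDisjunct I h (disj e as) =
  ∃[ g ] (InDom {k = e} I g × All (HoldsAtom I [ h , g ]) as)

_⊨_ : {S : Schema} → Structure S → Dexr S → Set
I ⊨ dexr v b hd = ∀ (h : Fin v → Const) → InDom I h → All (HoldsAtom I h) b →
  Any (SatDisjunct I h) hd

_⊨*_ : {S : Schema} → Structure S → List (Dexr S) → Set
I ⊨* Σ' = All (I ⊨_) Σ'

FinAxBy : {S : Schema} → (Dexr S → Set) → Collection S → Set₁
FinAxBy {S} P C = Σ (List (Dexr S)) λ Σ' → All P Σ' ×
  (∀ (I : Structure S) → (C I → I ⊨* Σ') × (I ⊨* Σ' → C I))

FinAxByNML : {S : Schema} → ℕ → ℕ → ℕ → Collection S → Set₁
FinAxByNML n m ℓ C = FinAxBy (IsNMLDexr n m ℓ) C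

FinAxByLinear : {S : Schema} → Collection S → Set₁
FinAxByLinear C = FinAxBy IsLinearDexr C

Term : ℕ → Set
Term m = Fin m ⊎ Const

evalTerm : {m : ℕ} → (Fin m → Const) → Term m → Const
evalTerm a (inj₁ j) = a j
evalTerm a (inj₂ c) = c

Conj : Schema → ℕ → Set
Conj S m = List (Atom S (Term m))

InC : {S : Schema} (K : Structure S) (m : ℕ) → Conj S m → Set
InC K m γ = All (λ a → ∀ i → ∀ c → lookup (Atom.args a) i ≡ inj₂ c → dom K c) γ

SatEx : {S : Schema} {m : ℕ} → Structure S → Conj S m → Set
SatEx {m = m} J γ = ∃[ a ] (InDom {k = m} J a × All (HoldsAtom J (evalTerm a)) γ)

InN : {S : Schema} (I K : Structure S) (m : ℕ) → Conj S m → Set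
InN I K m γ = InC K m γ × ¬ SatEx I γ

SatDiagram : {S : Schema} {m : ℕ} → Structure S → Structure S → List (Conj S m) → Set
-- (the conjuncts ¬(c = d) for distinct constants c ≠ d hold in every
-- structure, since constants are interpreted as themselves)
SatDiagram J K G =
  (∀ R t → rel K R t → rel J R t) ×
  All (λ γ → ¬ SatEx J γ) G

LinDiagCompatWith : {S : Schema} → Collection S → ℕ → ℕ → ℕ → Structure S → Set₁
LinDiagCompatWith {S} C n m ℓ I =
  ∀ (K : Structure S) → K ⊆ₛ I → LinearStr K → DomIsAdom K → DomCard≤ K n →
  ∀ (G : List (Conj S m)) → length G ≤ ℓ → All (InN I K m) G →
  Σ (Structure S) λ J → C J × SatDiagram J K G

LinDiagCompatible : {S : Schema} → Collection S → ℕ → ℕ → ℕ → Set₁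
LinDiagCompatible {S} C n m ℓ =
  ∀ (I : Structure S) → LinDiagCompatWith C n m ℓ I → C I

-- Rules are insensitive to duplicating elements (strong retractions), and linear rules are
-- preserved by arbitrary unions.
--
-- From compatibility to linear axioms: take for ΣL the finitely many linear consequences of
-- the (n,m,ℓ)-axioms Σ₀ with at most m existential variables per disjunct. If I ⊨ ΣL but a
-- linear diagram of K ⊆ I had no model in C, the rule whose body is the fact of K and whose
-- head is the disjunction of the excluded conjunctions (elements of K read as variables)
-- would be such a consequence violated by I.
--
-- From linear axioms to compatibility: if I violated σ ∈ Σ₀ at h, split the body of σ under h
-- into single facts. Compatibility realises each piece in C avoiding every conjunction that
-- is false in I and is obtained from a head disjunct by deciding, for each existential
-- variable, whether it denotes some h j, an element private to the piece, or neither; at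
-- most ℓ (n + 2)^m of them are needed. Renaming these realisations apart outside their
-- pieces, their union is again in C, so it satisfies a disjunct of σ; the witness then
-- splits along the pieces and reassembles into a witness in I, a contradiction.

module Submission where

open import Defs
open import Level using (0ℓ)
open import Axiom.ExcludedMiddle using (ExcludedMiddle)
open import Function using (_∘_; id)
open import Data.Empty using (⊥; ⊥-elim)
open import Data.Unit using (⊤; tt)
open import Data.Bool using (Bool; T)
open import Data.Maybe using (Maybe; just; nothing)
open import Data.Product using (Σ; ∃; ∃-syntax; _×_; _,_; proj₁; proj₂)
open import Data.Sum using (_⊎_; inj₁; inj₂)
open import Data.Nat using (ℕ; zero; suc; _+_; _*_; _^_; _≤_; _<_; _∸_; _⊔_; _/_; _%_; z≤n; s≤s; NonZero; >-nonZero; >-nonZero⁻¹)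
open import Data.Nat.Divisibility using (divides-refl)
import Data.Nat.Properties as ℕ
import Data.Nat.DivMod as ℕ
open import Data.Fin using (Fin)
import Data.Fin as Fin
import Data.Fin.Properties as Fin
open import Data.Vec using (Vec; []; _∷_; lookup; map; tabulate; toList)
import Data.Vec.Properties as Vec
open import Data.Vec.Membership.Propositional using () renaming (_∈_ to _∈ᵥ_)
import Data.Vec.Membership.Propositional.Properties as Vec
import Data.Vec.Relation.Unary.Any as VecAny
import Data.Vec.Relation.Unary.Any.Properties as VecAny
open import Data.List using (List; []; _∷_; length; allFin; upTo; filter; concatMap; deduplicate; _++_)
import Data.List as List
import Data.List.Properties as List
open import Data.List.Relation.Unary.All using (All; []; _∷_)
import Data.List.Relation.Unary.All as All
import Data.List.Relation.Unary.All.Properties as All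
open import Data.List.Relation.Unary.Any using (Any; here; there)
import Data.List.Relation.Unary.Any as Any
import Data.List.Relation.Unary.Any.Properties as Any
open import Data.List.Relation.Unary.AllPairs using (_∷_)
open import Data.List.Relation.Unary.Unique.Propositional using (Unique)
open import Data.List.Relation.Unary.Unique.Propositional.Properties using (Unique[x∷xs]⇒x∉xs)
open import Data.List.Relation.Unary.Unique.DecPropositional.Properties using (deduplicate-!)
open import Data.List.Membership.Propositional using (_∈_; find; lose)
open import Data.List.Membership.Propositional.Properties
open import Relation.Nullary using (¬_; Dec; yes; no)
open import Relation.Nullary.Decidable using (isYes; toWitness; fromWitness)
open import Relation.Binary.PropositionalEquality hiding ([_]; J)

map-cong-lookup : ∀ {A B : Set} {k} (f g : A → B) (xs : Vec A k) →
  (∀ i → f (lookup xs i) ≡ g (lookup xs i)) → map f xs ≡ map g xs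
map-cong-lookup f g []       eq = refl
map-cong-lookup f g (x ∷ xs) eq = cong₂ _∷_ (eq Fin.zero) (map-cong-lookup f g xs (eq ∘ Fin.suc))

lookup-ext : ∀ {A : Set} {k} (xs ys : Vec A k) → (∀ i → lookup xs i ≡ lookup ys i) → xs ≡ ys
lookup-ext xs ys eq = trans (sym (Vec.tabulate∘lookup xs)) (trans (Vec.tabulate-cong eq) (Vec.tabulate∘lookup ys))

lookup-injective : ∀ {A : Set} {xs : List A} → Unique xs → ∀ i j → List.lookup xs i ≡ List.lookup xs j → i ≡ j
lookup-injective {xs = _ ∷ _} u Fin.zero Fin.zero _ = refl
lookup-injective {xs = _ ∷ _} u Fin.zero (Fin.suc j) eq =
  ⊥-elim (Unique[x∷xs]⇒x∉xs u (subst (_∈ _) (sym eq) (∈-lookup j)))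
lookup-injective {xs = _ ∷ _} u (Fin.suc i) Fin.zero eq =
  ⊥-elim (Unique[x∷xs]⇒x∉xs u (subst (_∈ _) eq (∈-lookup i)))
lookup-injective {xs = _ ∷ _} (_ ∷ u) (Fin.suc i) (Fin.suc j) eq = cong Fin.suc (lookup-injective u i j eq)

sublists : ∀ {A : Set} → List A → List (List A)
sublists []       = [] ∷ []
sublists (x ∷ xs) = List.map (x ∷_) (sublists xs) ++ sublists xs

filter∈sublists : ∀ {A : Set} {P : A → Set} (P? : ∀ x → Dec (P x)) (xs : List A) →
  filter P? xs ∈ sublists xs
filter∈sublists P? [] = here refl
filter∈sublists P? (x ∷ xs) with P? x
... | yes _ = ∈-++⁺ˡ (∈-map⁺ (x ∷_) (filter∈sublists P? xs))
... | no _  = ∈-++⁺ʳ (List.map (x ∷_) (sublists xs)) (filter∈sublists P? xs)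

vectors : ∀ {A : Set} → List A → (k : ℕ) → List (Vec A k)
vectors xs zero    = [] ∷ []
vectors xs (suc k) = concatMap (λ x → List.map (x ∷_) (vectors xs k)) xs

∈-vectors : ∀ {A : Set} {xs : List A} → (∀ a → a ∈ xs) → ∀ {k} (t : Vec A k) → t ∈ vectors xs k
∈-vectors all∈ []      = here refl
∈-vectors all∈ (x ∷ t) = ∈-concatMap⁺ _ (lose (all∈ x) (∈-map⁺ (x ∷_) (∈-vectors all∈ t)))

length-concatMap-const : ∀ {A B : Set} (f : A → List B) {c} (xs : List A) → (∀ x → length (f x) ≡ c) →
  length (concatMap f xs) ≡ length xs * c
length-concatMap-const f []       eq = refl
length-concatMap-const f (x ∷ xs) eq = trans (List.length-++ (f x)) (cong₂ _+_ (eq x) (length-concatMap-const f xs eq))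

length-vectors : ∀ {A : Set} (xs : List A) k → length (vectors xs k) ≡ length xs ^ k
length-vectors xs zero    = refl
length-vectors xs (suc k) = length-concatMap-const _ xs
  (λ x → trans (List.length-map (x ∷_) (vectors xs k)) (length-vectors xs k))

sup : ∀ {v} → (Fin v → ℕ) → ℕ
sup {v} f = List.foldr (λ i acc → f i ⊔ acc) 0 (allFin v)

≤-sup : ∀ {v} (f : Fin v → ℕ) i → f i ≤ sup f
≤-sup {v} f i = go (allFin v) (∈-allFin i)
  where
  go : ∀ is → i ∈ is → f i ≤ List.foldr (λ i acc → f i ⊔ acc) 0 is
  go (_ ∷ _)  (here refl) = ℕ.m≤m⊔n _ _
  go (j ∷ is) (there i∈)  = ℕ.≤-trans (go is i∈) (ℕ.m≤n⊔m (f j) _)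

nonempty : ∀ {A : Set} {x : A} {xs : List A} → x ∈ xs → 1 ≤ length xs
nonempty {xs = _ ∷ _} _ = s≤s z≤n

some-member : ∀ {A : Set} (xs : List A) → 1 ≤ length xs → ∃[ x ] (x ∈ xs)
some-member (x ∷ _) _ = x , here refl

AllEntries : {A : Set} → (A → Set) → {k : ℕ} → Vec A k → Set
AllEntries P t = ∀ i → P (lookup t i)

[]-unique : ∀ {A : Set} (xs : List A) → (∀ x → ¬ x ∈ xs) → xs ≡ []
[]-unique []      _     = refl
[]-unique (x ∷ _) no-x = ⊥-elim (no-x x (here refl))

module _ {A : Set} {P : A → Set} (P? : ∀ x → Dec (P x)) where

  find-just : ∀ xs {x} → List.find P? xs ≡ just x → x ∈ xs × P x
  find-just (y ∷ xs) eq with P? y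
  find-just (y ∷ xs) refl | yes py = here refl , py
  ... | no _ = let x∈ , px = find-just xs eq in there x∈ , px

  find-nothing : ∀ xs → List.find P? xs ≡ nothing → All (¬_ ∘ P) xs
  find-nothing []       _  = []
  find-nothing (y ∷ xs) eq with P? y
  find-nothing (y ∷ xs) () | yes _
  ... | no ¬py = ¬py ∷ find-nothing xs eq

module _ {S : Schema} where

  renameAtom : {T T′ : Set} → (T → T′) → Atom S T → Atom S T′
  renameAtom r (atom R u) = atom R (map r u)

  holds-cong-lookup : ∀ {T : Set} (J : Structure S) (f g : T → Const) (a : Atom S T) →
    (∀ i → f (lookup (Atom.args a) i) ≡ g (lookup (Atom.args a) i)) → HoldsAtom J f a → HoldsAtom J g a
  holds-cong-lookup J f g (atom R u) eq = subst (rel J R) (map-cong-lookup f g u eq)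

  holds-cong : ∀ {T : Set} (J : Structure S) {f g : T → Const} (a : Atom S T) →
    (∀ x → f x ≡ g x) → HoldsAtom J f a → HoldsAtom J g a
  holds-cong J a eq = holds-cong-lookup J _ _ a (λ i → eq _)

  holds-rename⁻ : ∀ {T T′ : Set} (J : Structure S) (f : T′ → Const) (r : T → T′) (a : Atom S T) →
    HoldsAtom J f (renameAtom r a) → HoldsAtom J (f ∘ r) a
  holds-rename⁻ J f r (atom R u) = subst (rel J R) (sym (Vec.map-∘ f r u))

  holds-rename⁺ : ∀ {T T′ : Set} (J : Structure S) (f : T′ → Const) (r : T → T′) (a : Atom S T) →
    HoldsAtom J (f ∘ r) a → HoldsAtom J f (renameAtom r a)
  holds-rename⁺ J f r (atom R u) = subst (rel J R) (Vec.map-∘ f r u)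

  holds-dom : ∀ {T : Set} (J : Structure S) (f : T → Const) (a : Atom S T) →
    HoldsAtom J f a → ∀ i → dom J (f (lookup (Atom.args a) i))
  holds-dom J f (atom R u) H i = subst (dom J) (Vec.lookup-map i f u) (rel-dom J R (map f u) H i)

  occurs⇒dom : ∀ (J : Structure S) {v} (h : Fin v → Const) (body : List (Atom S (Fin v))) →
    All (HoldsAtom J h) body → ∀ x → OccursIn x body → dom J (h x)
  occurs⇒dom J h (a ∷ _) (H ∷ _) x (here (i , refl)) = holds-dom J h a H i
  occurs⇒dom J h (_ ∷ body) (_ ∷ Hs) x (there o) = occurs⇒dom J h body Hs x o

  satisfiesBody : ∀ (J : Structure S) {v} (h : Fin v → Const) (body : List (Atom S (Fin v))) →
    (∀ x → OccursIn x body) → All (HoldsAtom J h) body → InDom J h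
  satisfiesBody J h body occ Hs x = occurs⇒dom J h body Hs x (occ x)

  no-args-over-Fin0 : ∀ R → Vec (Fin 0) (ar S R) → ⊥
  no-args-over-Fin0 R u with ar S R | ar-pos S R | u
  ... | suc _ | _ | () ∷ _

  WF⇒symbols : ∀ {σ : Dexr S} → WF σ → 1 ≤ size S
  WF⇒symbols {dexr _ _ head} (_ , head-nonempty , atoms-nonempty)
    with some-member head head-nonempty
  ... | d , d∈ with some-member (atoms d) (All.lookup atoms-nonempty d∈)
  ...   | atom R _ , _ = >-nonZero⁻¹ (size S) {{Fin.nonZeroIndex R}}

-- Strong retractions

module _ {S : Schema} where

  -- J′ arises from J by duplicating elements: π collapses the copies, s picks one.
  record StrongRetraction (J J′ : Structure S) : Set where
    field
      π s    : Const → Const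
      π-dom  : ∀ x → dom J′ x → dom J (π x)
      s-dom  : ∀ d → dom J d → dom J′ (s d)
      π∘s    : ∀ d → dom J d → π (s d) ≡ d
      π-rel  : ∀ R t → rel J′ R t → rel J R (map π t)
      π-rel⁻ : ∀ R t → AllEntries (dom J′) t → rel J R (map π t) → rel J′ R t

    holds-π : ∀ {T : Set} (f : T → Const) (a : Atom S T) → HoldsAtom J′ f a → HoldsAtom J (π ∘ f) a
    holds-π f (atom R u) H = subst (rel J R) (sym (Vec.map-∘ π f u)) (π-rel R _ H)

    holds-π⁻ : ∀ {T : Set} (f : T → Const) (f′ : T → Const) (a : Atom S T) →
      (∀ x → dom J′ (f′ x)) → (∀ x → π (f′ x) ≡ f x) → HoldsAtom J f a → HoldsAtom J′ f′ a
    holds-π⁻ f f′ (atom R u) D eq H =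
      π-rel⁻ R (map f′ u) (λ i → subst (dom J′) (sym (Vec.lookup-map i f′ u)) (D _))
        (subst (rel J R) (trans (Vec.map-cong (sym ∘ eq) u) (Vec.map-∘ π f′ u)) H)

    preserves-⊨ : ∀ ρ → J ⊨ ρ → J′ ⊨ ρ
    preserves-⊨ (dexr v body head) J⊨ h′ D B =
      Any.map lift (J⊨ (π ∘ h′) (λ x → π-dom _ (D x)) (All.map (λ {a} → holds-π h′ a) B))
      where
      lift : ∀ {d} → SatDisjunct J (π ∘ h′) d → SatDisjunct J′ h′ d
      lift {disj e as} (g , Dg , A) = s ∘ g , (λ z → s-dom _ (Dg z)) ,
        All.map (λ {a} → holds-π⁻ [ π ∘ h′ , g ] [ h′ , s ∘ g ] a dom′ agree) A
        where
        dom′ : ∀ x → dom J′ ([ h′ , s ∘ g ] x)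
        dom′ (inj₁ x) = D x
        dom′ (inj₂ z) = s-dom _ (Dg z)
        agree : ∀ x → π ([ h′ , s ∘ g ] x) ≡ [ π ∘ h′ , g ] x
        agree (inj₁ x) = refl
        agree (inj₂ z) = π∘s _ (Dg z)

    reflects-⊨ : ∀ ρ → J′ ⊨ ρ → J ⊨ ρ
    reflects-⊨ (dexr v body head) J′⊨ h D B =
      Any.map lower (J′⊨ (s ∘ h) (λ x → s-dom _ (D x))
        (All.map (λ {a} → holds-π⁻ h (s ∘ h) a (λ x → s-dom _ (D x)) (λ x → π∘s _ (D x))) B))
      where
      lower : ∀ {d} → SatDisjunct J′ (s ∘ h) d → SatDisjunct J h d
      lower {disj e as} (g , Dg , A) = π ∘ g , (λ z → π-dom _ (Dg z)) ,
        All.map (λ {a} H → holds-cong J a agree (holds-π [ s ∘ h , g ] a H)) A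
        where
        agree : ∀ x → π ([ s ∘ h , g ] x) ≡ [ h , π ∘ g ] x
        agree (inj₁ x) = π∘s _ (D x)
        agree (inj₂ z) = refl

    preserves-⊨* : ∀ Σ′ → J ⊨* Σ′ → J′ ⊨* Σ′
    preserves-⊨* Σ′ = All.map (λ {ρ} → preserves-⊨ ρ)

    reflects-SatEx : ∀ {m} (K : Structure S) (γ : Conj S m) → InC K m γ →
      (∀ x → dom K x → π x ≡ x) → SatEx J′ γ → SatEx J γ
    reflects-SatEx {m} K γ γ∈C πK (a , Da , A) = π ∘ a , (λ y → π-dom _ (Da y)) , go γ γ∈C A
      where
      go : ∀ γ → InC K m γ → All (HoldsAtom J′ (evalTerm a)) γ → All (HoldsAtom J (evalTerm (π ∘ a))) γ
      go []      _          _        = []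
      go (b ∷ γ) (cb ∷ cs) (Hb ∷ Hs) = holds-cong-lookup J _ _ b agree (holds-π (evalTerm a) b Hb) ∷ go γ cs Hs
        where
        agree : ∀ i → π (evalTerm a (lookup (Atom.args b) i)) ≡ evalTerm (π ∘ a) (lookup (Atom.args b) i)
        agree i with lookup (Atom.args b) i in eq
        ... | inj₁ y = refl
        ... | inj₂ x = πK x (cb i x eq)

  pullback : (J : Structure S) (Tag : Const → Set) (π : Const → Const) → Structure S
  pullback J Tag π = record
    { dom     = dom′
    ; rel     = λ R t → AllEntries dom′ t × rel J R (map π t)
    ; rel-dom = λ _ _ → proj₁ }
    where
    dom′ : Const → Set
    dom′ x = Tag x × dom J (π x)

  pullback-retraction : (J : Structure S) (Tag : Const → Set) (π s : Const → Const) →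
    (∀ d → dom J d → Tag (s d)) → (∀ d → dom J d → π (s d) ≡ d) → StrongRetraction J (pullback J Tag π)
  pullback-retraction J Tag π s tag π∘s = record
    { π = π ; s = s ; π-dom = λ _ → proj₂
    ; s-dom = λ d Dd → tag d Dd , subst (dom J) (sym (π∘s d Dd)) Dd
    ; π∘s = π∘s ; π-rel = λ _ _ → proj₂ ; π-rel⁻ = λ _ _ → _,_ }

-- Small structures and unions

module _ {S : Schema} where

  ⋃ : ∀ {P} → (Fin P → Structure S) → Structure S
  ⋃ {P} Js = record
    { dom     = λ x → ∃[ f ] dom (Js f) x
    ; rel     = λ R t → ∃[ f ] rel (Js f) R t
    ; rel-dom = λ R t (f , r) i → f , rel-dom (Js f) R t r i }

  ∅ : Structure S
  ∅ = record { dom = λ _ → ⊥ ; rel = λ _ _ → ⊥ ; rel-dom = λ _ _ () }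

  singleton : ∀ R → Vec Const (ar S R) → Structure S
  singleton R t = record
    { dom     = λ x → ∃[ i ] lookup t i ≡ x
    ; rel     = λ R′ t′ → _≡_ {A = Fact S} (R′ , t′) (R , t)
    ; rel-dom = λ { _ _ refl i → i , refl } }

  singleton-linear : ∀ R t → LinearStr (singleton R t)
  singleton-linear R t eq eq′ = trans eq (sym eq′)

  singleton-adom : ∀ R t → DomIsAdom (singleton R t)
  singleton-adom R t x x∈ = R , t , refl , x∈

  singleton⊆ : ∀ {J : Structure S} R t → rel J R t → singleton R t ⊆ₛ J
  singleton⊆ R t Rt _ _ refl = Rt

  SatDisjunct-mono : ∀ {J J′ : Structure S} → (∀ x → dom J x → dom J′ x) → J ⊆ₛ J′ →
    ∀ {v} (h : Fin v → Const) d → SatDisjunct J h d → SatDisjunct J′ h d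
  SatDisjunct-mono dom⊆ rel⊆ h (disj e as) (g , Dg , A) =
    g , (λ z → dom⊆ _ (Dg z)) , All.map (λ { {atom R u} → rel⊆ R _ }) A

  ⋃-preserves-linear : ∀ {P} (Js : Fin (suc P) → Structure S) σ → IsLinearDexr σ →
    (∀ f → Js f ⊨ σ) → ⋃ Js ⊨ σ
  ⋃-preserves-linear Js (dexr v [] head) ((occ , _) , _) Js⊨ h _ [] =
    Any.map (λ {d} → SatDisjunct-mono {Js Fin.zero} {⋃ Js} (λ _ → Fin.zero ,_) (λ _ _ → Fin.zero ,_) h d)
      (Js⊨ Fin.zero h (λ x → ⊥-elim (noOcc (occ x))) [])
    where
    noOcc : ∀ {x : Fin v} → ¬ OccursIn {S} x []
    noOcc ()
  ⋃-preserves-linear Js (dexr v (atom R u ∷ []) head) ((occ , _) , _) Js⊨ h _ ((f , r) ∷ []) =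
    Any.map (λ {d} → SatDisjunct-mono {Js f} {⋃ Js} (λ _ → f ,_) (λ _ _ → f ,_) h d)
      (Js⊨ f h (satisfiesBody (Js f) h _ occ (r ∷ [])) (r ∷ []))
  ⋃-preserves-linear Js (dexr v (_ ∷ _ ∷ _) head) (_ , s≤s ())

-- Patterns of tuples

record Pattern {k : ℕ} (t : Vec Const k) : Set where
  field
    width            : ℕ
    name             : Fin width → Const
    name-injective   : ∀ i j → name i ≡ name j → i ≡ j
    shape            : Vec (Fin width) k
    name-shape       : ∀ i → name (lookup shape i) ≡ lookup t i
    shape-surjective : ∀ j → ∃[ i ] (lookup shape i ≡ j)
    width≤           : width ≤ k

pattern-of : ∀ {k} (t : Vec Const k) → Pattern t
pattern-of {k} t = record
  { width            = length names
  ; name             = List.lookup names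
  ; name-injective   = lookup-injective (deduplicate-! ℕ._≟_ (toList t))
  ; shape            = tabulate (Any.index ∘ entry∈names)
  ; name-shape       = name-shape
  ; shape-surjective = surjective
  ; width≤           = subst (length names ≤_) (Vec.length-toList t) (List.length-deduplicate ℕ._≟_ (toList t)) }
  where
  names : List Const
  names = deduplicate ℕ._≟_ (toList t)
  entry∈names : ∀ i → lookup t i ∈ names
  entry∈names i = ∈-deduplicate⁺ ℕ._≟_ (Vec.∈-toList⁺ (Vec.∈-lookup i t))
  name-shape : ∀ i → List.lookup names (lookup (tabulate (Any.index ∘ entry∈names)) i) ≡ lookup t i
  name-shape i = trans (cong (List.lookup names) (Vec.lookup∘tabulate _ i)) (sym (Any.lookup-index (entry∈names i)))
  surjective : ∀ j → ∃[ i ] (lookup (tabulate (Any.index ∘ entry∈names)) i ≡ j)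
  surjective j = i , lookup-injective (deduplicate-! ℕ._≟_ (toList t)) _ _ (trans (name-shape i) t[i]≡name)
    where
    name∈t : List.lookup names j ∈ᵥ t
    name∈t = Vec.∈-toList⁻ (∈-deduplicate⁻ ℕ._≟_ (toList t) (∈-lookup j))
    i = VecAny.index name∈t
    t[i]≡name : lookup t i ≡ List.lookup names j
    t[i]≡name = sym (VecAny.lookup-index name∈t)

map-name-shape : ∀ {k} {t : Vec Const k} (p : Pattern t) → map (Pattern.name p) (Pattern.shape p) ≡ t
map-name-shape {t = t} p = lookup-ext _ t (λ i → trans (Vec.lookup-map i name shape) (name-shape i))
  where open Pattern p

-- Tagged constants

%-tag : ∀ P .{{_ : NonZero P}} (f : Fin P) d → (Fin.toℕ f + d * P) % P ≡ Fin.toℕ f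
%-tag P f d = trans (ℕ.[m+kn]%n≡m%n (Fin.toℕ f) d P) (ℕ.m<n⇒m%n≡m (Fin.toℕ<n f))

/-tag : ∀ P .{{_ : NonZero P}} (f : Fin P) d → (Fin.toℕ f + d * P) / P ≡ d
/-tag P f d = begin
  (Fin.toℕ f + d * P) / P         ≡⟨ ℕ.+-distrib-/-∣ʳ (Fin.toℕ f) (divides-refl d) ⟩
  Fin.toℕ f / P + d * P / P     ≡⟨ cong₂ _+_ (ℕ.m<n⇒m/n≡0 (Fin.toℕ<n f)) (ℕ.m*n/n≡m d P) ⟩
  d                                 ∎
  where open ≡-Reasoning

-- What an existential witness is, relative to one piece: some h j, an element private to
-- the piece, or neither.
data Role (v : ℕ) : Set where
  absent fresh : Role v
  named        : Fin v → Role v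

roles : ∀ v → List (Role v)
roles v = absent ∷ fresh ∷ List.map named (allFin v)

∈-roles : ∀ {v} (r : Role v) → r ∈ roles v
∈-roles absent    = here refl
∈-roles fresh     = there (here refl)
∈-roles (named j) = there (there (∈-map⁺ named (∈-allFin j)))

length-roles : ∀ v → length (roles v) ≡ 2 + v
length-roles v = cong (2 +_) (trans (List.length-map named (allFin v)) (List.length-tabulate id))

nameOf : ∀ {v} → Role v → Maybe (Fin v)
nameOf (named j) = just j
nameOf _         = nothing

IsJust : ∀ {A : Set} → Maybe A → Set
IsJust (just _) = ⊤
IsJust nothing  = ⊥

module _ (em : ExcludedMiddle 0ℓ) {S : Schema} where

  dec : (P : Set) → Dec P
  dec P = em

  ¬All¬⇒Any : ∀ {A : Set} {P : A → Set} (xs : List A) → ¬ All (¬_ ∘ P) xs → Any P xs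
  ¬All¬⇒Any []       ¬all = ⊥-elim (¬all [])
  ¬All¬⇒Any {P = P} (x ∷ xs) ¬all with dec (P x)
  ... | yes px = here px
  ... | no ¬px = there (¬All¬⇒Any xs (¬all ∘ (¬px ∷_)))

  ¬∀⇒∃¬ : ∀ {k} {X : Fin k → Set} → ¬ (∀ i → X i) → ∃[ i ] ¬ X i
  ¬∀⇒∃¬ {k} {X} = Fin.¬∀⟶∃¬ k X (λ _ → dec _)

  stable : ∀ {X : Set} → ¬ ¬ X → X
  stable {X} ¬¬x with dec X
  ... | yes x = x
  ... | no ¬x = ⊥-elim (¬¬x ¬x)

  -- Bool-valued structures form a small type, so excluded middle at level 0 decides
  -- statements quantifying over them.
  record BoolStructure : Set where
    field
      bdom    : Const → Bool
      brel    : (R : Fin (size S)) → Vec Const (ar S R) → Bool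
      bdom-ok : ∀ R t → T (brel R t) → ∀ i → T (bdom (lookup t i))

  ⟦_⟧ : BoolStructure → Structure S
  ⟦ b ⟧ = record { dom = T ∘ bdom ; rel = λ R → T ∘ brel R ; rel-dom = bdom-ok }
    where open BoolStructure b

  boolCopy : Structure S → BoolStructure
  boolCopy J = record
    { bdom    = λ c → isYes (dec (dom J c))
    ; brel    = λ R t → isYes (dec (rel J R t))
    ; bdom-ok = λ R t r i → fromWitness (rel-dom J R t (toWitness r) i) }

  boolCopy-retraction : (J : Structure S) → StrongRetraction J ⟦ boolCopy J ⟧
  boolCopy-retraction J = record
    { π = id ; s = id
    ; π-dom  = λ _ → toWitness
    ; s-dom  = λ _ → fromWitness
    ; π∘s    = λ _ _ → refl
    ; π-rel  = λ R t r → subst (rel J R) (sym (Vec.map-id t)) (toWitness r)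
    ; π-rel⁻ = λ R t _ r → fromWitness (subst (rel J R) (Vec.map-id t) r) }

  ⊆-boolCopy : ∀ {K J : Structure S} → K ⊆ₛ J → K ⊆ₛ ⟦ boolCopy J ⟧
  ⊆-boolCopy K⊆J R t r = fromWitness (K⊆J R t r)

  module Relabel (J : Structure S) {v : ℕ} (c : Fin v → Const) (c-injective : ∀ i j → c i ≡ c j → i ≡ j)
                 (h : Fin v → Const) where

    B : ℕ
    B = suc (sup c)

    c<B : ∀ j → c j < B
    c<B j = s≤s (≤-sup c j)

    π : Const → Const
    π x with dec (∃[ j ] c j ≡ x)
    ... | yes (j , _) = h j
    ... | no _        = x ∸ B

    π-name : ∀ j → π (c j) ≡ h j
    π-name j with dec (∃[ j′ ] c j′ ≡ c j)
    ... | yes (j′ , eq) = cong h (c-injective j′ j eq)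
    ... | no ¬named     = ⊥-elim (¬named (j , refl))

    π-shift : ∀ d → π (d + B) ≡ d
    π-shift d with dec (∃[ j ] c j ≡ d + B)
    ... | yes (j , eq) = ⊥-elim (ℕ.<⇒≱ (c<B j) (subst (B ≤_) (sym eq) (ℕ.m≤n+m B d)))
    ... | no _         = ℕ.m+n∸n≡m d B

    Tag : Const → Set
    Tag x = (∃[ j ] c j ≡ x) ⊎ B ≤ x

    relabelled : Structure S
    relabelled = pullback J Tag π

    retraction : StrongRetraction J relabelled
    retraction = pullback-retraction J Tag π (_+ B) (λ d _ → inj₂ (ℕ.m≤n+m B d)) (λ d _ → π-shift d)

    rel-named : InDom J h → ∀ R (u : Vec (Fin v) (ar S R)) → rel J R (map h u) → rel relabelled R (map c u)
    rel-named Dh R u r =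
      (λ i → subst (λ x → Tag x × dom J (π x)) (sym (Vec.lookup-map i c u))
               (inj₁ (lookup u i , refl) , subst (dom J) (sym (π-name _)) (Dh _))) ,
      subst (rel J R) (trans (Vec.map-cong (sym ∘ π-name) u) (Vec.map-∘ π c u)) r

  module Tagging (P : ℕ) .{{_ : NonZero P}} (B : ℕ) (f : Fin P) (J K : Structure S)
                 (K<B : ∀ x → dom K x → x < B) (K⊆J : K ⊆ₛ J) where

    s : Const → Const
    s d with dec (dom K d)
    ... | yes _ = d
    ... | no _  = B + (Fin.toℕ f + d * P)

    π : Const → Const
    π x with dec (dom K x)
    ... | yes _ = x
    ... | no _  = (x ∸ B) / P

    Tag : Const → Set
    Tag x = dom K x ⊎ (B ≤ x × (x ∸ B) % P ≡ Fin.toℕ f)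

    tagged : Structure S
    tagged = pullback J Tag π

    ≥B⇒∉K : ∀ x → B ≤ x → ¬ dom K x
    ≥B⇒∉K x B≤x x∈K = ℕ.<⇒≱ (K<B x x∈K) B≤x

    π-fixes-K : ∀ x → dom K x → π x ≡ x
    π-fixes-K x x∈K with dec (dom K x)
    ... | yes _  = refl
    ... | no x∉K = ⊥-elim (x∉K x∈K)

    π∘s : ∀ d → π (s d) ≡ d
    π∘s d with dec (dom K d)
    ... | yes d∈K = π-fixes-K d d∈K
    ... | no _ with dec (dom K (B + (Fin.toℕ f + d * P)))
    ...   | yes x∈K = ⊥-elim (≥B⇒∉K _ (ℕ.m≤m+n B _) x∈K)
    ...   | no _    = trans (cong (_/ P) (ℕ.m+n∸m≡n B _)) (/-tag P f d)

    tag-s : ∀ d → Tag (s d)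
    tag-s d with dec (dom K d)
    ... | yes d∈K = inj₁ d∈K
    ... | no _    = inj₂ (ℕ.m≤m+n B _ , trans (cong (_% P) (ℕ.m+n∸m≡n B _)) (%-tag P f d))

    retraction : StrongRetraction J tagged
    retraction = pullback-retraction J Tag π s (λ d _ → tag-s d) (λ d _ → π∘s d)

    K⊆tagged : K ⊆ₛ tagged
    K⊆tagged R t r =
      (λ i → let x∈K = rel-dom K R t r i in
               inj₁ x∈K , subst (dom J) (sym (π-fixes-K _ x∈K)) (rel-dom J R t (K⊆J R t r) i)) ,
      subst (rel J R) (sym (trans (map-cong-lookup π id t (λ i → π-fixes-K _ (rel-dom K R t r i))) (Vec.map-id t)))
        (K⊆J R t r)

    <B⇒K : ∀ x → dom tagged x → x < B → dom K x
    <B⇒K x (inj₁ x∈K , _)       _   = x∈K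
    <B⇒K x (inj₂ (B≤x , _) , _) x<B = ⊥-elim (ℕ.<⇒≱ x<B B≤x)

    tag-outside-K : ∀ x → dom tagged x → ¬ dom K x → (x ∸ B) % P ≡ Fin.toℕ f
    tag-outside-K x (inj₁ x∈K , _)     x∉K = ⊥-elim (x∉K x∈K)
    tag-outside-K x (inj₂ (_ , eq) , _) _  = eq

  allAtoms : {X : Set} → List X → List (Atom S X)
  allAtoms xs = concatMap (λ R → List.map (atom R) (vectors xs (ar S R))) (allFin (size S))

  ∈-allAtoms : ∀ {X : Set} {xs : List X} → (∀ x → x ∈ xs) → ∀ a → a ∈ allAtoms xs
  ∈-allAtoms all∈ (atom R u) = ∈-concatMap⁺ _ (lose (∈-allFin R) (∈-map⁺ (atom R) (∈-vectors all∈ u)))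

  variables : (v e : ℕ) → List (Fin v ⊎ Fin e)
  variables v e = List.map inj₁ (allFin v) ++ List.map inj₂ (allFin e)

  ∈-variables : ∀ {v e} x → x ∈ variables v e
  ∈-variables     (inj₁ j) = ∈-++⁺ˡ (∈-map⁺ inj₁ (∈-allFin j))
  ∈-variables {v} (inj₂ z) = ∈-++⁺ʳ (List.map inj₁ (allFin v)) (∈-map⁺ inj₂ (∈-allFin z))

  -- A conjunction whose constants are among the names c j becomes a head disjunct
  -- by reading c j as the universal variable j.
  module Generalisation (m : ℕ) {v : ℕ} (c : Fin v → Const) where

    instantiate : Fin v ⊎ Fin m → Term m
    instantiate (inj₁ j) = inj₂ (c j)
    instantiate (inj₂ y) = inj₁ y

    generalise : Conj S m → List (Atom S (Fin v ⊎ Fin m))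
    generalise γ = filter (λ a → dec (renameAtom instantiate a ∈ γ)) (allAtoms (variables v m))

    ConstantsNamed : Conj S m → Set
    ConstantsNamed γ = All (λ a → ∀ i x → lookup (Atom.args a) i ≡ inj₂ x → ∃[ j ] c j ≡ x) γ

    preimage : ∀ {k} (u : Vec (Term m) k) → (∀ i x → lookup u i ≡ inj₂ x → ∃[ j ] c j ≡ x) →
      ∃[ u′ ] map instantiate u′ ≡ u
    preimage []           _       = [] , refl
    preimage (inj₁ y ∷ u) u-named = let u′ , eq = preimage u (u-named ∘ Fin.suc) in inj₂ y ∷ u′ , cong (inj₁ y ∷_) eq
    preimage (inj₂ x ∷ u) u-named =
      let j , cj≡x = u-named Fin.zero x refl
          u′ , eq  = preimage u (u-named ∘ Fin.suc)
      in inj₁ j ∷ u′ , cong₂ _∷_ (cong inj₂ cj≡x) eq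

    preimage-atom : ∀ (b : Atom S (Term m)) → (∀ i x → lookup (Atom.args b) i ≡ inj₂ x → ∃[ j ] c j ≡ x) →
      ∃[ a ] renameAtom instantiate a ≡ b
    preimage-atom (atom R u) b-named = let u′ , eq = preimage u b-named in atom R u′ , cong (atom R) eq

    ∈-generalise : ∀ {γ} (a : Atom S (Fin v ⊎ Fin m)) → renameAtom instantiate a ∈ γ → a ∈ generalise γ
    ∈-generalise a a∈γ = ∈-filter⁺ (λ a → dec (renameAtom instantiate a ∈ _)) (∈-allAtoms ∈-variables a) a∈γ

    generalise-nonempty : ∀ γ → ConstantsNamed γ → 1 ≤ length γ → 1 ≤ length (generalise γ)
    generalise-nonempty (b ∷ γ) (b-named ∷ _) _ =
      let a , eq = preimage-atom b b-named in nonempty (∈-generalise {b ∷ γ} a (here eq))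

    SatDisjunct-generalise⇒SatEx : ∀ (I : Structure S) γ → ConstantsNamed γ →
      SatDisjunct I c (disj m (generalise γ)) → SatEx I γ
    SatDisjunct-generalise⇒SatEx I γ γ-named (g , Dg , A) = g , Dg , All.tabulate holds
      where
      agree : ∀ x → [ c , g ] x ≡ evalTerm g (instantiate x)
      agree (inj₁ j) = refl
      agree (inj₂ y) = refl
      holds : ∀ {b} → b ∈ γ → HoldsAtom I (evalTerm g) b
      holds {b} b∈γ = let a , eq = preimage-atom b (All.lookup γ-named b∈γ) in
        subst (HoldsAtom I (evalTerm g)) eq (holds-rename⁺ I (evalTerm g) instantiate a
          (holds-cong I a agree (All.lookup A (∈-generalise a (subst (_∈ γ) (sym eq) b∈γ)))))

    SatEx⇒SatDisjunct-generalise : ∀ {J J′ : Structure S} (r : StrongRetraction J J′) (h : Fin v → Const) →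
      (∀ j → StrongRetraction.π r (c j) ≡ h j) → ∀ γ → SatEx J′ γ → SatDisjunct J h (disj m (generalise γ))
    SatEx⇒SatDisjunct-generalise {J} r h π-name γ (a , Da , A) = π ∘ a , (λ y → π-dom _ (Da y)) , All.tabulate holds
      where
      open StrongRetraction r
      agree : ∀ x → π (evalTerm a (instantiate x)) ≡ [ h , π ∘ a ] x
      agree (inj₁ j) = π-name j
      agree (inj₂ y) = refl
      holds : ∀ {b} → b ∈ generalise γ → HoldsAtom J [ h , π ∘ a ] b
      holds {b} b∈ = holds-cong J b agree
        (holds-rename⁻ J (π ∘ evalTerm a) instantiate b
          (holds-π (evalTerm a) _ (All.lookup A (proj₂ (∈-filter⁻ (λ a → dec (renameAtom instantiate a ∈ γ))
                                                           {xs = allAtoms (variables v m)} b∈)))))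


  linearPremises : List (Σ ℕ λ v → List (Atom S (Fin v)))
  linearPremises = (0 , []) ∷ concatMap factPremises (allFin (size S))
    where
    factPremises : Fin (size S) → List (Σ ℕ λ v → List (Atom S (Fin v)))
    factPremises R = concatMap (λ v → List.map (λ p → v , atom R p ∷ []) (vectors (allFin v) (ar S R)))
                             (upTo (suc (ar S R)))

  ∈-linearPremises : ∀ R {v} (p : Vec (Fin v) (ar S R)) → v ≤ ar S R → (v , atom R p ∷ []) ∈ linearPremises
  ∈-linearPremises R {v} p v≤ar = there (∈-concatMap⁺ _ (lose (∈-allFin R)
    (∈-concatMap⁺ _ (lose (∈-upTo⁺ (s≤s v≤ar)) (∈-map⁺ (λ p → v , atom R p ∷ []) (∈-vectors ∈-allFin p))))))

  module FromCompatibility (C : Collection S) (m : ℕ) (Σ₀ : List (Dexr S)) (Σ₀-wf : All WF Σ₀)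
                           (Σ₀-axiomatises : ∀ I → (C I → I ⊨* Σ₀) × (I ⊨* Σ₀ → C I)) where

    rulesWithPremise : Σ ℕ (λ v → List (Atom S (Fin v))) → List (Dexr S)
    rulesWithPremise (v , premise) =
      List.map (λ heads → dexr v premise (List.map (disj m) heads)) (sublists (sublists (allAtoms (variables v m))))

    candidates : List (Dexr S)
    candidates = concatMap rulesWithPremise linearPremises ++ Σ₀

    Entailed : Dexr S → Set
    Entailed ρ = ∀ b → ⟦ b ⟧ ⊨* Σ₀ → ⟦ b ⟧ ⊨ ρ

    LinearConsequence : Dexr S → Set
    LinearConsequence ρ = IsLinearDexr ρ × Entailed ρ

    ΣL : List (Dexr S)
    ΣL = filter (λ ρ → dec (LinearConsequence ρ)) candidates

    ∈ΣL : ∀ {ρ} → ρ ∈ candidates → LinearConsequence ρ → ρ ∈ ΣL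
    ∈ΣL = ∈-filter⁺ (λ ρ → dec (LinearConsequence ρ))

    ΣL-linear : All IsLinearDexr ΣL
    ΣL-linear = All.tabulate (proj₁ ∘ proj₂ ∘ ∈-filter⁻ (λ ρ → dec (LinearConsequence ρ)) {xs = candidates})

    C⇒⊨ΣL : ∀ J → C J → J ⊨* ΣL
    C⇒⊨ΣL J J∈C = All.tabulate λ {ρ} ρ∈ΣL →
      let entailed = proj₂ (proj₂ (∈-filter⁻ (λ ρ → dec (LinearConsequence ρ)) {xs = candidates} ρ∈ΣL)) in
      reflects-⊨ ρ (entailed (boolCopy J) (preserves-⊨* Σ₀ (proj₁ (Σ₀-axiomatises J) J∈C)))
      where open StrongRetraction (boolCopy-retraction J)

    record LinearBody (I K : Structure S) : Set₁ where
      field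
        width          : ℕ
        name           : Fin width → Const
        name-injective : ∀ i j → name i ≡ name j → i ≡ j
        premise        : List (Atom S (Fin width))
        premise∈       : (width , premise) ∈ linearPremises
        premise-occ    : ∀ x → OccursIn x premise
        premise-linear : length premise ≤ 1
        premise-holds  : All (HoldsAtom I name) premise
        K-named        : ∀ x → dom K x → ∃[ j ] name j ≡ x
        K⊆relabelled   : ∀ J h → InDom J h → All (HoldsAtom J h) premise →
                         K ⊆ₛ Relabel.relabelled J name name-injective h

    linearBody-empty : ∀ {I K} → DomIsAdom K → (∀ R t → ¬ rel K R t) → LinearBody I K
    linearBody-empty K-adom K-empty = record
      { width = 0 ; name = λ () ; name-injective = λ () ; premise = [] ; premise∈ = here refl
      ; premise-occ = λ () ; premise-linear = z≤n ; premise-holds = []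
      ; K-named      = λ x x∈K → let R , t , r , _ = K-adom x x∈K in ⊥-elim (K-empty R t r)
      ; K⊆relabelled = λ _ _ _ _ R t r → ⊥-elim (K-empty R t r) }

    linearBody-fact : ∀ {I K} → K ⊆ₛ I → LinearStr K → DomIsAdom K → ∀ R t → rel K R t → LinearBody I K
    linearBody-fact {I} {K} K⊆I K-linear K-adom R t Rt = record
      { width = width ; name = name ; name-injective = name-injective
      ; premise = atom R shape ∷ [] ; premise∈ = ∈-linearPremises R shape width≤
      ; premise-occ = λ x → here (shape-surjective x) ; premise-linear = s≤s z≤n
      ; premise-holds = subst (rel I R) (sym (map-name-shape p)) (K⊆I R t Rt) ∷ []
      ; K-named = K-named ; K⊆relabelled = K⊆relabelled }
      where
      p = pattern-of t
      open Pattern p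
      K-named : ∀ x → dom K x → ∃[ j ] name j ≡ x
      K-named x x∈K with K-adom x x∈K
      ... | R′ , t′ , R′t′ , i , eq with K-linear Rt R′t′
      ...   | refl = lookup shape i , trans (name-shape i) eq
      K⊆relabelled : ∀ J h → InDom J h → All (HoldsAtom J h) (atom R shape ∷ []) →
        K ⊆ₛ Relabel.relabelled J name name-injective h
      K⊆relabelled J h Dh (Rh ∷ []) R′ t′ R′t′ with K-linear Rt R′t′
      ... | refl = subst (rel (Relabel.relabelled J name name-injective h) R) (map-name-shape p)
                     (Relabel.rel-named J name name-injective h Dh R shape Rh)

    linearBody : ∀ {I K} → K ⊆ₛ I → LinearStr K → DomIsAdom K → LinearBody I K
    linearBody {K = K} K⊆I K-linear K-adom with dec (Σ (Fin (size S)) λ R → Σ (Vec Const (ar S R)) λ t → rel K R t)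
    ... | yes (R , t , Rt) = linearBody-fact K⊆I K-linear K-adom R t Rt
    ... | no no-fact       = linearBody-empty K-adom (λ R t Rt → no-fact (R , t , Rt))

    Realisable : Structure S → List (Conj S m) → Set
    Realisable K G = Σ BoolStructure λ b → ⟦ b ⟧ ⊨* Σ₀ × SatDiagram ⟦ b ⟧ K G

    -- If the diagram is unrealisable, the rule "premise(name) → ⋁ γ∈G ∃ȳ γ" with the names
    -- generalised to variables is a linear consequence of Σ₀ that fails in I.
    module Unrealisable {I K : Structure S} (lb : LinearBody I K) (G : List (Conj S m))
                        (G∈N : All (InN I K m) G) where
      open LinearBody lb
      open Generalisation m name

      G-named : ∀ {γ} → γ ∈ G → ConstantsNamed γ
      G-named γ∈G = All.map (λ in-K i x eq → K-named x (in-K i x eq)) (proj₁ (All.lookup G∈N γ∈G))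

      IsHead : List (Atom S (Fin width ⊎ Fin m)) → Set
      IsHead s = s ∈ List.map generalise G

      heads : List (List (Atom S (Fin width ⊎ Fin m)))
      heads = filter (λ s → dec (IsHead s)) (sublists (allAtoms (variables width m)))

      rule : Dexr S
      rule = dexr width premise (List.map (disj m) heads)

      generalise∈heads : ∀ {γ} → γ ∈ G → generalise γ ∈ heads
      generalise∈heads γ∈G = ∈-filter⁺ (λ s → dec (IsHead s))
        (filter∈sublists (λ a → dec (renameAtom instantiate a ∈ _)) (allAtoms (variables width m)))
        (∈-map⁺ generalise γ∈G)

      head∈heads⇒generalise : ∀ {s} → s ∈ heads → ∃[ γ ] (γ ∈ G × s ≡ generalise γ)
      head∈heads⇒generalise s∈ = ∈-map⁻ generalise
        (proj₂ (∈-filter⁻ (λ s → dec (IsHead s)) {xs = sublists (allAtoms (variables width m))} s∈))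

      rule-linear : All (λ γ → 1 ≤ length γ) G → 1 ≤ length G → IsLinearDexr rule
      rule-linear γs-nonempty G-nonempty =
        (premise-occ , heads-nonempty , All.tabulate disjuncts-nonempty) , premise-linear
        where
        heads-nonempty : 1 ≤ length (List.map (disj m) heads)
        heads-nonempty = let _ , γ∈G = some-member G G-nonempty in nonempty (∈-map⁺ (disj m) (generalise∈heads γ∈G))
        disjuncts-nonempty : ∀ {d} → d ∈ List.map (disj m) heads → 1 ≤ length (atoms d)
        disjuncts-nonempty d∈ with ∈-map⁻ (disj m) d∈
        ... | s , s∈heads , refl with head∈heads⇒generalise s∈heads
        ...   | γ , γ∈G , refl = generalise-nonempty γ (G-named γ∈G) (All.lookup γs-nonempty γ∈G)

      rule-entailed : ¬ Realisable K G → Entailed rule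
      rule-entailed unrealisable b b⊨Σ₀ h Dh premise-h =
        Any.map⁺ (lose (generalise∈heads γ∈G)
          (SatEx⇒SatDisjunct-generalise retraction h π-name γ (reflects-SatEx′ γ∈G sat)))
        where
        open Relabel ⟦ b ⟧ name name-injective h
        copy = boolCopy relabelled
        copy⊨Σ₀ : ⟦ copy ⟧ ⊨* Σ₀
        copy⊨Σ₀ = StrongRetraction.preserves-⊨* (boolCopy-retraction relabelled) Σ₀
                    (StrongRetraction.preserves-⊨* retraction Σ₀ b⊨Σ₀)
        K⊆copy : K ⊆ₛ ⟦ copy ⟧
        K⊆copy = ⊆-boolCopy {K} {relabelled} (K⊆relabelled ⟦ b ⟧ h Dh premise-h)
        some-sat : Any (SatEx ⟦ copy ⟧) G
        some-sat = ¬All¬⇒Any G (λ none → unrealisable (copy , copy⊨Σ₀ , K⊆copy , none))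
        γ = proj₁ (find some-sat)
        γ∈G = proj₁ (proj₂ (find some-sat))
        sat = proj₂ (proj₂ (find some-sat))
        reflects-SatEx′ : ∀ {γ} → γ ∈ G → SatEx ⟦ copy ⟧ γ → SatEx relabelled γ
        reflects-SatEx′ {γ} γ∈G = StrongRetraction.reflects-SatEx (boolCopy-retraction relabelled)
                                    K γ (proj₁ (All.lookup G∈N γ∈G)) (λ _ _ → refl)

      rule-fails : ¬ I ⊨ rule
      rule-fails I⊨rule with find (Any.map⁻ (I⊨rule name (satisfiesBody I name premise premise-occ premise-holds) premise-holds))
      ... | s , s∈heads , sat with head∈heads⇒generalise s∈heads
      ...   | γ , γ∈G , refl = proj₂ (All.lookup G∈N γ∈G) (SatDisjunct-generalise⇒SatEx I γ (G-named γ∈G) sat)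

    realisable : ∀ {I K} → I ⊨* ΣL → LinearBody I K → ∀ G → All (InN I K m) G →
      All (λ γ → 1 ≤ length γ) G → 1 ≤ length G → Realisable K G
    realisable {K = K} I⊨ΣL lb G G∈N γs-nonempty G-nonempty with dec (Realisable K G)
    ... | yes r = r
    ... | no unrealisable = ⊥-elim (rule-fails (All.lookup I⊨ΣL (∈ΣL rule∈ (rule-linear γs-nonempty G-nonempty ,
                                                                         rule-entailed unrealisable))))
      where
      open Unrealisable lb G G∈N
      open LinearBody lb using (width; premise; premise∈)
      rule∈ : rule ∈ candidates
      rule∈ = ∈-++⁺ˡ (∈-concatMap⁺ rulesWithPremise (lose premise∈
                (∈-map⁺ (λ heads → dexr width premise (List.map (disj m) heads))
                  (filter∈sublists (λ s → dec (IsHead s)) (sublists (allAtoms (variables width m)))))))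

    full : Structure S
    full = record { dom = λ _ → ⊤ ; rel = λ _ _ → ⊤ ; rel-dom = λ _ _ _ _ → tt }

    full⊨ : ∀ σ → WF σ → full ⊨ σ
    full⊨ (dexr v b (disj e as ∷ _)) _ h _ _ = here ((λ _ → 0) , (λ _ → tt) , All.tabulate (λ { {atom R u} _ → tt }))
    full⊨ (dexr v b [])             (_ , () , _)

    empty⇒⊨Σ₀ : ∀ I → (∀ x → ¬ dom I x) → I ⊨* ΣL → I ⊨* Σ₀
    empty⇒⊨Σ₀ I empty I⊨ΣL = All.tabulate λ {σ} → model σ
      where
      model : ∀ σ → σ ∈ Σ₀ → I ⊨ σ
      model (dexr (suc v) _ _)            _  h Dh _ = ⊥-elim (empty _ (Dh Fin.zero))
      model (dexr zero (atom R u ∷ _) _) _  = ⊥-elim (no-args-over-Fin0 {S} R u)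
      model (dexr zero [] _)             σ∈ = All.lookup I⊨ΣL
        (∈ΣL (∈-++⁺ʳ (concatMap rulesWithPremise linearPremises) σ∈)
             ((All.lookup Σ₀-wf σ∈ , z≤n) , λ b b⊨Σ₀ → All.lookup b⊨Σ₀ σ∈))

    compatible : ∀ n ℓ I → I ⊨* ΣL → LinDiagCompatWith C n m ℓ I
    compatible n ℓ I I⊨ΣL K K⊆I K-linear K-adom _ [] _ _ =
      full , proj₂ (Σ₀-axiomatises full) (All.map (λ {σ} → full⊨ σ) Σ₀-wf) , (λ _ _ _ → tt) , []
    compatible n ℓ I I⊨ΣL K K⊆I K-linear K-adom _ G@(_ ∷ _) _ G∈N with dec (Any (_≡ []) G)
    ... | yes []∈G = I , proj₂ (Σ₀-axiomatises I) (empty⇒⊨Σ₀ I empty I⊨ΣL) , K⊆I , All.map proj₂ G∈N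
      where
      -- ∃ȳ ⊤ is false only in the empty structure
      empty : ∀ x → ¬ dom I x
      empty x x∈I = let γ , γ∈G , γ≡[] = find []∈G in
        proj₂ (All.lookup G∈N γ∈G) (subst (SatEx I) (sym γ≡[]) ((λ _ → x) , (λ _ → x∈I) , []))
    ... | no []∉G =
      let b , b⊨Σ₀ , diagram = realisable {I} {K} I⊨ΣL (linearBody {I} {K} K⊆I K-linear K-adom) G G∈N
                                  (All.tabulate nonempty-γ) (s≤s z≤n)
      in ⟦ b ⟧ , proj₂ (Σ₀-axiomatises ⟦ b ⟧) b⊨Σ₀ , diagram
      where
      nonempty-γ : ∀ {γ} → γ ∈ G → 1 ≤ length γ
      nonempty-γ {[]}    γ∈G = ⊥-elim ([]∉G (lose γ∈G refl))
      nonempty-γ {_ ∷ _} _   = s≤s z≤n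

    finAxByLinear : ∀ n ℓ → LinDiagCompatible C n m ℓ → FinAxByLinear C
    finAxByLinear n ℓ compat = ΣL , ΣL-linear , λ I → C⇒⊨ΣL I , λ I⊨ΣL → compat I (compatible n ℓ I I⊨ΣL)


  module ToCompatibility (C : Collection S) (n m ℓ : ℕ)
           (Σ₀ : List (Dexr S)) (Σ₀-nml : All (IsNMLDexr n m ℓ) Σ₀)
           (Σ₀-axiomatises : ∀ I → (C I → I ⊨* Σ₀) × (I ⊨* Σ₀ → C I))
           (ΣL : List (Dexr S)) (ΣL-linear : All IsLinearDexr ΣL)
           (ΣL-axiomatises : ∀ I → (C I → I ⊨* ΣL) × (I ⊨* ΣL → C I))
           (ℓ′ : ℕ) (ℓ′-bound : 1 ≤ size S → ℓ * (2 + n) ^ m ≤ ℓ′)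
           (I : Structure S) (compat : LinDiagCompatWith C n m ℓ′ I) where

    module Violation {v} (body : List (Atom S (Fin v))) (head : List (Disjunct S v)) (σ∈Σ₀ : dexr v body head ∈ Σ₀)
                     (h : Fin v → Const) (Dh : InDom I h) (body-h : All (HoldsAtom I h) body)
                     (violated : ¬ Any (SatDisjunct I h) head) (d₀ : Const) (d₀∈I : dom I d₀) where

      σ-wf     = proj₁ (All.lookup Σ₀-nml σ∈Σ₀)
      v≤n      = proj₁ (proj₂ (All.lookup Σ₀-nml σ∈Σ₀))
      head≤m   = proj₁ (proj₂ (proj₂ (All.lookup Σ₀-nml σ∈Σ₀)))
      head≤ℓ   = proj₂ (proj₂ (proj₂ (All.lookup Σ₀-nml σ∈Σ₀)))

      Named : Const → Set
      Named x = ∃[ j ] h j ≡ x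

      B : ℕ
      B = suc (sup h)

      named<B : ∀ {x} → Named x → x < B
      named<B (j , refl) = s≤s (≤-sup h j)

      P : ℕ
      P = suc (length body)

      K : Fin P → Structure S
      K Fin.zero    = ∅
      K (Fin.suc i) = singleton (Atom.sym a) (map h (Atom.args a))
        where a = List.lookup body i

      K-named : ∀ f x → dom (K f) x → Named x
      K-named (Fin.suc i) x (k , eq) =
        lookup (Atom.args (List.lookup body i)) k , trans (sym (Vec.lookup-map k h (Atom.args (List.lookup body i)))) eq

      K⊆I : ∀ f → K f ⊆ₛ I
      K⊆I (Fin.suc i) = singleton⊆ {J = I} (Atom.sym a) (map h (Atom.args a)) (All.lookup body-h (∈-lookup i))
        where a = List.lookup body i

      K-linear : ∀ f → LinearStr (K f)
      K-linear Fin.zero ()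
      K-linear (Fin.suc i) = singleton-linear {S} _ _

      K-adom : ∀ f → DomIsAdom (K f)
      K-adom (Fin.suc i) = singleton-adom {S} _ _

      K-card : ∀ f → DomCard≤ (K f) n
      K-card f = List.map h (allFin v)
               , subst (_≤ n) (sym (trans (List.length-map h (allFin v)) (List.length-tabulate id))) v≤n
               , λ x x∈K → let j , eq = K-named f x x∈K in subst (_∈ _) eq (∈-map⁺ h (∈-allFin j))

      Present : Fin P → Role v → Set
      Present f absent    = ⊥
      Present f fresh     = ⊤
      Present f (named j) = dom (K f) (h j)

      module Candidate (e : ℕ) .(e≤m : e ≤ m) (as : List (Atom S (Fin v ⊎ Fin e))) where

        ι : Fin e → Fin m
        ι z = Fin.inject≤ z e≤m

        existential : Maybe (Fin v) → Fin e → Term m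
        existential (just j) z = inj₂ (h j)
        existential nothing  z = inj₁ (ι z)

        term : Vec (Maybe (Fin v)) e → Fin v ⊎ Fin e → Term m
        term κ (inj₁ x) = inj₂ (h x)
        term κ (inj₂ z) = existential (lookup κ z) z

        translate : Vec (Maybe (Fin v)) e → Atom S (Fin v ⊎ Fin e) → Atom S (Term m)
        translate κ = renameAtom (term κ)

        Constant : Vec (Maybe (Fin v)) e → Fin v ⊎ Fin e → Set
        Constant κ (inj₁ _) = ⊤
        Constant κ (inj₂ z) = IsJust (lookup κ z)

        Ground : Vec (Maybe (Fin v)) e → Atom S (Fin v ⊎ Fin e) → Set
        Ground κ a = ∀ i → Constant κ (lookup (Atom.args a) i)

        groundAtoms : Vec (Maybe (Fin v)) e → List (Atom S (Fin v ⊎ Fin e))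
        groundAtoms κ = filter (λ a → dec (Ground κ a)) as

        Fresh : Vec (Role v) e → Fin v ⊎ Fin e → Set
        Fresh θ (inj₁ _) = ⊥
        Fresh θ (inj₂ z) = lookup θ z ≡ fresh

        Allowed : Fin P → Vec (Role v) e → Fin v ⊎ Fin e → Set
        Allowed f θ (inj₁ x) = dom (K f) (h x)
        Allowed f θ (inj₂ z) = Present f (lookup θ z)

        Local : Fin P → Vec (Role v) e → Atom S (Fin v ⊎ Fin e) → Set
        Local f θ a = (∃[ i ] Fresh θ (lookup (Atom.args a) i)) × (∀ i → Allowed f θ (lookup (Atom.args a) i))

        localAtoms : Fin P → Vec (Role v) e → List (Atom S (Fin v ⊎ Fin e))
        localAtoms f θ = filter (λ a → dec (Local f θ a)) as

        Unsatisfiable : Atom S (Term m) → Set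
        Unsatisfiable α = ¬ SatEx I (α ∷ [])

        missing : Vec (Maybe (Fin v)) e → Maybe (Atom S (Term m))
        missing κ = List.find (λ α → dec (Unsatisfiable α)) (List.map (translate κ) (groundAtoms κ))

        candidate′ : Fin P → Vec (Maybe (Fin v)) e → Vec (Role v) e → Conj S m
        candidate′ f κ θ with missing κ
        ... | just α  = α ∷ []
        ... | nothing = List.map (translate κ) (localAtoms f θ)

        candidate : Fin P → Vec (Role v) e → Conj S m
        candidate f θ = candidate′ f (map nameOf θ) θ

        candidate′-just : ∀ {f κ θ α} → missing κ ≡ just α → candidate′ f κ θ ≡ α ∷ []
        candidate′-just eq rewrite eq = refl

        candidate′-nothing : ∀ {f κ θ} → missing κ ≡ nothing →
          candidate′ f κ θ ≡ List.map (translate κ) (localAtoms f θ)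
        candidate′-nothing eq rewrite eq = refl

      candidatesFor : Fin P → (ds : List (Disjunct S v)) → All (λ d → nex d ≤ m) ds → List (Conj S m)
      candidatesFor f []               []            = []
      candidatesFor f (disj e as ∷ ds) (e≤m ∷ ds≤m) =
        List.map (Candidate.candidate e e≤m as f) (vectors (roles v) e) ++ candidatesFor f ds ds≤m

      ∈-candidatesFor : ∀ f {ds} (ds≤m : All (λ d → nex d ≤ m) ds) {e as} → disj e as ∈ ds →
        (e≤m : e ≤ m) (θ : Vec (Role v) e) → Candidate.candidate e e≤m as f θ ∈ candidatesFor f ds ds≤m
      ∈-candidatesFor f (_ ∷ _) {e} {as} (here refl) e≤m θ =
        ∈-++⁺ˡ (∈-map⁺ (Candidate.candidate e e≤m as f) (∈-vectors ∈-roles θ))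
      ∈-candidatesFor f (_ ∷ ds≤m) (there d∈) e≤m θ =
        ∈-++⁺ʳ _ (∈-candidatesFor f ds≤m d∈ e≤m θ)

      length-candidatesFor : ∀ f ds (ds≤m : All (λ d → nex d ≤ m) ds) →
        length (candidatesFor f ds ds≤m) ≤ length ds * (2 + v) ^ m
      length-candidatesFor f []               []            = z≤n
      length-candidatesFor f (disj e as ∷ ds) (e≤m ∷ ds≤m) = begin
        length (List.map _ (vectors (roles v) e) ++ candidatesFor f ds ds≤m)
          ≡⟨ List.length-++ (List.map _ (vectors (roles v) e)) ⟩
        length (List.map _ (vectors (roles v) e)) + length (candidatesFor f ds ds≤m)
          ≡⟨ cong (_+ _) (trans (List.length-map _ (vectors (roles v) e))
                         (trans (length-vectors (roles v) e) (cong (_^ e) (length-roles v)))) ⟩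
        (2 + v) ^ e + length (candidatesFor f ds ds≤m)
          ≤⟨ ℕ.+-mono-≤ (ℕ.^-monoʳ-≤ (2 + v) e≤m) (length-candidatesFor f ds ds≤m) ⟩
        (2 + v) ^ m + length ds * (2 + v) ^ m ∎
        where open ℕ.≤-Reasoning

      G : Fin P → List (Conj S m)
      G f = filter (λ γ → dec (InN I (K f) m γ)) (candidatesFor f head head≤m)

      G-length : ∀ f → length (G f) ≤ ℓ′
      G-length f = begin
        length (G f)                         ≤⟨ List.length-filter _ (candidatesFor f head head≤m) ⟩
        length (candidatesFor f head head≤m) ≤⟨ length-candidatesFor f head head≤m ⟩
        length head * (2 + v) ^ m            ≤⟨ ℕ.*-mono-≤ head≤ℓ (ℕ.^-monoˡ-≤ m (ℕ.+-monoʳ-≤ 2 v≤n)) ⟩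
        ℓ * (2 + n) ^ m                      ≤⟨ ℓ′-bound (WF⇒symbols σ-wf) ⟩
        ℓ′                                   ∎
        where open ℕ.≤-Reasoning

      G⊆N : ∀ f → All (InN I (K f) m) (G f)
      G⊆N f = All.tabulate (proj₂ ∘ ∈-filter⁻ (λ γ → dec (InN I (K f) m γ)) {xs = candidatesFor f head head≤m})

      -- Kept abstract: otherwise every `with` over J f normalises the compatibility proof.
      abstract
        realisation : ∀ f → Σ (Structure S) λ J → C J × SatDiagram J (K f) (G f)
        realisation f = compat (K f) (K⊆I f) (K-linear f) (K-adom f) (K-card f) (G f) (G-length f) (G⊆N f)

      J : Fin P → Structure S
      J f = proj₁ (realisation f)

      J-avoids : ∀ f → All (λ γ → ¬ SatEx (J f) γ) (G f)
      J-avoids f = proj₂ (proj₂ (proj₂ (realisation f)))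

      module T (f : Fin P) = Tagging P B f (J f) (K f) (λ x x∈K → named<B (K-named f x x∈K))
                                     (proj₁ (proj₂ (proj₂ (realisation f))))

      J″ : Fin P → Structure S
      J″ f = T.tagged f

      U : Structure S
      U = ⋃ J″

      U∈C : C U
      U∈C = proj₂ (ΣL-axiomatises U) (All.tabulate λ {ρ} ρ∈ΣL →
        ⋃-preserves-linear J″ ρ (All.lookup ΣL-linear ρ∈ΣL) λ f →
          StrongRetraction.preserves-⊨ (T.retraction f) ρ
            (All.lookup (proj₁ (ΣL-axiomatises (J f)) (proj₁ (proj₂ (realisation f)))) ρ∈ΣL))

      body-U : All (HoldsAtom U h) body
      body-U = All.tabulate λ {a} a∈ → let i = Any.index a∈ in
        Fin.suc i , subst (HoldsAtom (J″ (Fin.suc i)) h) (sym (Any.lookup-index a∈))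
                      (T.K⊆tagged (Fin.suc i) _ _ refl)

      head-U : Any (SatDisjunct U h) head
      head-U = All.lookup (proj₁ (Σ₀-axiomatises U) U∈C) σ∈Σ₀ h (satisfiesBody U h body (proj₁ σ-wf) body-U) body-U

      named∈J″⇒K : ∀ f {x} → dom (J″ f) x → Named x → dom (K f) x
      named∈J″⇒K f x∈ x-named = T.<B⇒K f _ x∈ (named<B x-named)

      unnamed-in-one-piece : ∀ {f f′ x} → dom (J″ f) x → dom (J″ f′) x → ¬ Named x → f ≡ f′
      unnamed-in-one-piece {f} {f′} x∈ x∈′ unnamed = Fin.toℕ-injective
        (trans (sym (T.tag-outside-K f _ x∈ (unnamed ∘ K-named f _))) (T.tag-outside-K f′ _ x∈′ (unnamed ∘ K-named f′ _)))

      data NameView (x : Const) : Maybe (Fin v) → Set where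
        is-name : ∀ j → h j ≡ x → NameView x (just j)
        no-name : ¬ Named x → NameView x nothing

      nameOfConst : Const → Maybe (Fin v)
      nameOfConst x with dec (Named x)
      ... | yes (j , _) = just j
      ... | no _        = nothing

      nameView : ∀ x → NameView x (nameOfConst x)
      nameView x with dec (Named x)
      ... | yes (j , eq) = is-name j eq
      ... | no unnamed   = no-name unnamed

      role : Fin P → Const → Role v
      role f x with dec (Named x)
      ... | yes (j , _) = named j
      ... | no _ with dec (dom (J″ f) x)
      ...   | yes _ = fresh
      ...   | no _  = absent

      nameOf-role : ∀ f x → nameOf (role f x) ≡ nameOfConst x
      nameOf-role f x with dec (Named x)
      ... | yes _ = refl
      ... | no _ with dec (dom (J″ f) x)
      ...   | yes _ = refl
      ...   | no _  = refl

      role-fresh : ∀ f x → ¬ Named x → dom (J″ f) x → role f x ≡ fresh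
      role-fresh f x unnamed x∈ with dec (Named x)
      ... | yes x-named = ⊥-elim (unnamed x-named)
      ... | no _ with dec (dom (J″ f) x)
      ...   | yes _ = refl
      ...   | no x∉ = ⊥-elim (x∉ x∈)

      role-fresh⁻ : ∀ f x → role f x ≡ fresh → ¬ Named x × dom (J″ f) x
      role-fresh⁻ f x eq with dec (Named x)
      role-fresh⁻ f x () | yes _
      ... | no unnamed with dec (dom (J″ f) x)
      ...   | yes x∈ = unnamed , x∈
      role-fresh⁻ f x () | no _ | no _

      role-present : ∀ f x → dom (J″ f) x → Present f (role f x)
      role-present f x x∈ with dec (Named x)
      ... | yes (j , refl) = named∈J″⇒K f x∈ (j , refl)
      ... | no _ with dec (dom (J″ f) x)
      ...   | yes _ = tt
      ...   | no x∉ = ⊥-elim (x∉ x∈)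

      module Refutation {e} {as} (d∈head : disj e as ∈ head) (g : Fin e → Const) (Dg : InDom U g)
                        (Hg : All (HoldsAtom U [ h , g ]) as) where
        open Candidate e (All.lookup head≤m d∈head) as

        κ : Vec (Maybe (Fin v)) e
        κ = tabulate (nameOfConst ∘ g)

        θ : Fin P → Vec (Role v) e
        θ f = tabulate (role f ∘ g)

        κ-view : ∀ z → NameView (g z) (lookup κ z)
        κ-view z = subst (NameView (g z)) (sym (Vec.lookup∘tabulate _ z)) (nameView (g z))

        θ-fresh⁻ : ∀ f z → lookup (θ f) z ≡ fresh → ¬ Named (g z) × dom (J″ f) (g z)
        θ-fresh⁻ f z eq = role-fresh⁻ f (g z) (trans (sym (Vec.lookup∘tabulate _ z)) eq)

        ∈G : ∀ f {γ} → candidate′ f κ (θ f) ≡ γ → InN I (K f) m γ → γ ∈ G f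
        ∈G f {γ} eq γ∈N = ∈-filter⁺ (λ γ → dec (InN I (K f) m γ))
          (subst (_∈ candidatesFor f head head≤m) (trans (cong (λ κ′ → candidate′ f κ′ (θ f)) names-θ) eq)
            (∈-candidatesFor f head≤m d∈head (All.lookup head≤m d∈head) (θ f)))
          γ∈N
          where
          names-θ : map nameOf (θ f) ≡ κ
          names-θ = trans (sym (Vec.tabulate-∘ nameOf (role f ∘ g))) (Vec.tabulate-cong (nameOf-role f ∘ g))

        Agrees : (Fin m → Const) → Atom S (Fin v ⊎ Fin e) → Set
        Agrees α a = ∀ i z → lookup (Atom.args a) i ≡ inj₂ z → lookup κ z ≡ nothing → α (ι z) ≡ g z

        translate-holds : ∀ X α a → HoldsAtom X [ h , g ] a → Agrees α a → HoldsAtom X (evalTerm α) (translate κ a)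
        translate-holds X α a H agrees = holds-rename⁺ X (evalTerm α) (term κ) a (holds-cong-lookup X _ _ a agree H)
          where
          agree : ∀ i → [ h , g ] (lookup (Atom.args a) i) ≡ evalTerm α (term κ (lookup (Atom.args a) i))
          agree i with lookup (Atom.args a) i in eq
          ... | inj₁ x = refl
          ... | inj₂ z with lookup κ z in κz | κ-view z
          ...   | just j  | is-name _ hj≡gz = sym hj≡gz
          ...   | nothing | no-name _       = sym (agrees i z eq κz)

        translate-holds⁻ : ∀ X w (a′ : Fin e → Const) a → HoldsAtom X (evalTerm w) (translate κ a) →
          (∀ i z → lookup (Atom.args a) i ≡ inj₂ z → evalTerm w (existential (lookup κ z) z) ≡ a′ z) →
          HoldsAtom X [ h , a′ ] a
        translate-holds⁻ X w a′ a H agrees = holds-cong-lookup X _ _ a agree (holds-rename⁻ X (evalTerm w) (term κ) a H)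
          where
          agree : ∀ i → evalTerm w (term κ (lookup (Atom.args a) i)) ≡ [ h , a′ ] (lookup (Atom.args a) i)
          agree i with lookup (Atom.args a) i in eq
          ... | inj₁ x = refl
          ... | inj₂ z = agrees i z eq

        constant-named : ∀ t c → term κ t ≡ inj₂ c → Named c × [ h , g ] t ≡ c
        constant-named (inj₁ x) c refl = (x , refl) , refl
        constant-named (inj₂ z) c eq with lookup κ z | κ-view z
        constant-named (inj₂ z) _ refl | just j  | is-name _ hj≡gz = (j , refl) , sym hj≡gz
        constant-named (inj₂ z) _ ()   | nothing | no-name _

        translate-constants : ∀ f a → HoldsAtom (J″ f) [ h , g ] a →
          ∀ i c → lookup (Atom.args (translate κ a)) i ≡ inj₂ c → dom (K f) c
        translate-constants f (atom R u) H i c eq =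
          let c-named , gt≡c = constant-named (lookup u i) c (trans (sym (Vec.lookup-map i (term κ) u)) eq)
          in named∈J″⇒K f (subst (dom (J″ f)) gt≡c (holds-dom (J″ f) [ h , g ] (atom R u) H i)) c-named

        ground-agrees : ∀ α a → Ground κ a → Agrees α a
        ground-agrees α a ground i z eq κz = ⊥-elim (subst IsJust κz (subst (Constant κ) eq (ground i)))

        no-missing-atom : ∀ α → missing κ ≡ just α → ⊥
        no-missing-atom α eq = All.lookup (J-avoids f) (∈G f (candidate′-just eq) (in-K ∷ [] , unsat))
          (StrongRetraction.reflects-SatEx (T.retraction f) (K f) (α ∷ []) (in-K ∷ []) (T.π-fixes-K f) sat)
          where
          α∈ = find-just (λ α → dec (Unsatisfiable α)) (List.map (translate κ) (groundAtoms κ)) eq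
          unsat = proj₂ α∈
          a = proj₁ (∈-map⁻ (translate κ) (proj₁ α∈))
          a∈ = ∈-filter⁻ (λ a → dec (Ground κ a)) {xs = as} (proj₁ (proj₂ (∈-map⁻ (translate κ) (proj₁ α∈))))
          α≡ = proj₂ (proj₂ (∈-map⁻ (translate κ) (proj₁ α∈)))
          f = proj₁ (All.lookup Hg (proj₁ a∈))
          Ha = proj₂ (All.lookup Hg (proj₁ a∈))
          in-K : ∀ i c → lookup (Atom.args α) i ≡ inj₂ c → dom (K f) c
          in-K = subst (λ α → ∀ i c → lookup (Atom.args α) i ≡ inj₂ c → dom (K f) c) (sym α≡)
                   (translate-constants f a Ha)
          i₀ = Fin.fromℕ< (ar-pos S (Atom.sym a))
          x₀ = [ h , g ] (lookup (Atom.args a) i₀)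
          sat : SatEx (J″ f) (α ∷ [])
          sat = (λ _ → x₀) , (λ _ → holds-dom (J″ f) [ h , g ] a Ha i₀) ,
                subst (HoldsAtom (J″ f) (evalTerm (λ _ → x₀))) (sym α≡)
                  (translate-holds (J″ f) _ a Ha (ground-agrees _ a (proj₂ a∈))) ∷ []

        fresh-position : ∀ f t → Fresh (θ f) t → ∃[ z ] (t ≡ inj₂ z × ¬ Named (g z) × dom (J″ f) (g z))
        fresh-position f (inj₂ z) eq = z , refl , θ-fresh⁻ f z eq

        local-holds : ∀ f a → a ∈ localAtoms f (θ f) → HoldsAtom (J″ f) [ h , g ] a
        local-holds f a a∈ = subst (λ f → HoldsAtom (J″ f) [ h , g ] a) (sym (unnamed-in-one-piece gz∈ gz∈′ unnamed)) Ha
          where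
          local = ∈-filter⁻ (λ a → dec (Local f (θ f) a)) {xs = as} a∈
          i = proj₁ (proj₁ (proj₂ local))
          fp = fresh-position f _ (proj₂ (proj₁ (proj₂ local)))
          z = proj₁ fp
          unnamed = proj₁ (proj₂ (proj₂ fp))
          gz∈ = proj₂ (proj₂ (proj₂ fp))
          f′ = proj₁ (All.lookup Hg (proj₁ local))
          Ha = proj₂ (All.lookup Hg (proj₁ local))
          gz∈′ : dom (J″ f′) (g z)
          gz∈′ = subst (dom (J″ f′)) (cong [ h , g ] (proj₁ (proj₂ fp))) (holds-dom (J″ f′) [ h , g ] a Ha i)

        Q : Fin P → Conj S m
        Q f = List.map (translate κ) (localAtoms f (θ f))

        Q-constants : ∀ f → InC (K f) m (Q f)
        Q-constants f = All.map⁺ (All.tabulate λ {a} a∈ → translate-constants f a (local-holds f a a∈))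

        valuation : Fin P → Const → Fin m → Const
        valuation f d y with dec (∃[ z ] ι z ≡ y × dom (J″ f) (g z))
        ... | yes (z , _) = g z
        ... | no _        = d

        valuation-dom : ∀ f {d} → dom (J″ f) d → ∀ y → dom (J″ f) (valuation f d y)
        valuation-dom f d∈ y with dec (∃[ z ] ι z ≡ y × dom (J″ f) (g z))
        ... | yes (_ , _ , gz∈) = gz∈
        ... | no _              = d∈

        valuation-agrees : ∀ f d z → dom (J″ f) (g z) → valuation f d (ι z) ≡ g z
        valuation-agrees f d z gz∈ with dec (∃[ z′ ] ι z′ ≡ ι z × dom (J″ f) (g z′))
        ... | yes (z′ , eq , _) = cong g (Fin.inject≤-injective _ _ z′ z eq)
        ... | no none           = ⊥-elim (none (z , refl , gz∈))

        Q-sat : ∀ f {d} → dom (J″ f) d → SatEx (J″ f) (Q f)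
        Q-sat f {d} d∈ = valuation f d , valuation-dom f d∈ , All.map⁺ (All.tabulate λ {a} a∈ →
          let Ha = local-holds f a a∈ in
          translate-holds (J″ f) (valuation f d) a Ha λ i z eq _ →
            valuation-agrees f d z (subst (dom (J″ f)) (cong [ h , g ] eq) (holds-dom (J″ f) [ h , g ] a Ha i)))

        Q-unsat-absurd : ∀ f → missing κ ≡ nothing → ¬ SatEx I (Q f) → ⊥
        Q-unsat-absurd f no-missing unsat with dec (∃[ x ] dom (J″ f) x)
        ... | yes (d , d∈) = All.lookup (J-avoids f) (∈G f (candidate′-nothing no-missing) (Q-constants f , unsat))
            (StrongRetraction.reflects-SatEx (T.retraction f) (K f) (Q f) (Q-constants f) (T.π-fixes-K f) (Q-sat f d∈))
        ... | no empty = unsat (subst (SatEx I) (sym Q≡[]) ((λ _ → d₀) , (λ _ → d₀∈I) , []))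
          where
          Q≡[] : Q f ≡ []
          Q≡[] = cong (List.map (translate κ)) ([]-unique _ λ a a∈ →
            empty (_ , holds-dom (J″ f) [ h , g ] a (local-holds f a a∈) (Fin.fromℕ< (ar-pos S (Atom.sym a)))))

        κ-nothing⇒unnamed : ∀ z → lookup κ z ≡ nothing → ¬ Named (g z)
        κ-nothing⇒unnamed z eq with lookup κ z | κ-view z
        κ-nothing⇒unnamed z () | just _  | _
        ... | nothing | no-name unnamed = unnamed

        nonconstant-position : ∀ t → ¬ Constant κ t → ∃[ z ] (t ≡ inj₂ z × lookup κ z ≡ nothing)
        nonconstant-position (inj₁ _) nonconstant = ⊥-elim (nonconstant tt)
        nonconstant-position (inj₂ z) nonconstant with lookup κ z in eq
        ... | just _  = ⊥-elim (nonconstant tt)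
        ... | nothing = z , refl , eq

        allowed : ∀ f t → dom (J″ f) ([ h , g ] t) → Allowed f (θ f) t
        allowed f (inj₁ x) hx∈ = named∈J″⇒K f hx∈ (x , refl)
        allowed f (inj₂ z) gz∈ = subst (Present f) (sym (Vec.lookup∘tabulate _ z)) (role-present f (g z) gz∈)

        module Combination (no-missing : missing κ ≡ nothing) (w : Fin P → Fin m → Const)
                           (w-dom : ∀ f y → dom I (w f y)) (w-sat : ∀ f → All (HoldsAtom I (evalTerm (w f))) (Q f)) where

          choose : Maybe (Fin v) → Fin e → Const
          choose (just j) z = h j
          choose nothing  z with dec (∃[ f ] dom (J″ f) (g z))
          ... | yes (f , _) = w f (ι z)
          ... | no _        = d₀

          witness : Fin e → Const
          witness z = choose (lookup κ z) z

          witness-dom : InDom I witness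
          witness-dom z with lookup κ z
          ... | just j = Dh j
          ... | nothing with dec (∃[ f ] dom (J″ f) (g z))
          ...   | yes (f , _) = w-dom f (ι z)
          ...   | no _        = d₀∈I

          witness-ground : ∀ u z → IsJust (lookup κ z) → evalTerm u (existential (lookup κ z) z) ≡ witness z
          witness-ground u z is-just with lookup κ z | is-just
          ... | just j | _ = refl

          witness-local : ∀ f z → dom (J″ f) (g z) → evalTerm (w f) (existential (lookup κ z) z) ≡ witness z
          witness-local f z gz∈ with lookup κ z | κ-view z
          ... | just j  | _ = refl
          ... | nothing | no-name unnamed with dec (∃[ f′ ] dom (J″ f′) (g z))
          ...   | yes (f′ , gz∈′) = cong (λ f → w f (ι z)) (unnamed-in-one-piece gz∈ gz∈′ unnamed)
          ...   | no none         = ⊥-elim (none (f , gz∈))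

          ground-holds : ∀ a → a ∈ as → Ground κ a → HoldsAtom I [ h , witness ] a
          ground-holds a a∈ ground =
            translate-holds⁻ I u witness a (All.head Hu) λ i z eq → witness-ground u z (subst (Constant κ) eq (ground i))
            where
            sat = stable (All.lookup (find-nothing (λ α → dec (Unsatisfiable α)) _ no-missing)
                                     (∈-map⁺ (translate κ) (∈-filter⁺ (λ a → dec (Ground κ a)) a∈ ground)))
            u = proj₁ sat
            Hu = proj₂ (proj₂ sat)

          local-atom-holds : ∀ a → a ∈ as → ¬ Ground κ a → HoldsAtom I [ h , witness ] a
          local-atom-holds a a∈ nonground =
            translate-holds⁻ I (w f) witness a (All.lookup (w-sat f) (∈-map⁺ (translate κ) a∈local))
              λ i z eq → witness-local f z (subst (dom (J″ f)) (cong [ h , g ] eq) (dom-at i))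
            where
            f = proj₁ (All.lookup Hg a∈)
            Ha = proj₂ (All.lookup Hg a∈)
            dom-at : ∀ i → dom (J″ f) ([ h , g ] (lookup (Atom.args a) i))
            dom-at = holds-dom (J″ f) [ h , g ] a Ha
            i = proj₁ (¬∀⇒∃¬ nonground)
            np = nonconstant-position _ (proj₂ (¬∀⇒∃¬ nonground))
            z = proj₁ np
            fresh-z : lookup (θ f) z ≡ fresh
            fresh-z = trans (Vec.lookup∘tabulate _ z)
              (role-fresh f (g z) (κ-nothing⇒unnamed z (proj₂ (proj₂ np)))
                (subst (dom (J″ f)) (cong [ h , g ] (proj₁ (proj₂ np))) (dom-at i)))
            a∈local : a ∈ localAtoms f (θ f)
            a∈local = ∈-filter⁺ (λ a → dec (Local f (θ f) a)) a∈
              ((i , subst (Fresh (θ f)) (sym (proj₁ (proj₂ np))) fresh-z) , λ i → allowed f (lookup (Atom.args a) i) (dom-at i))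

          satisfied : SatDisjunct I h (disj e as)
          satisfied = witness , witness-dom , All.tabulate λ {a} a∈ → holds a a∈ (dec (Ground κ a))
            where
            holds : ∀ a → a ∈ as → Dec (Ground κ a) → HoldsAtom I [ h , witness ] a
            holds a a∈ (yes ground)   = ground-holds a a∈ ground
            holds a a∈ (no nonground) = local-atom-holds a a∈ nonground

        -- An unsatisfiable ground atom holds in the piece where U satisfies it; otherwise either
        -- some piece satisfies its local atoms although I does not, or the witnesses in I for
        -- the local atoms of all pieces combine into a witness for the whole disjunct.
        refute : ⊥
        refute with missing κ in eq
        ... | just α  = no-missing-atom α eq
        ... | nothing with dec (∀ f → SatEx I (Q f))
        ...   | yes sat  = violated (lose d∈head (Combination.satisfied eq (proj₁ ∘ sat)
                                                  (proj₁ ∘ proj₂ ∘ sat) (proj₂ ∘ proj₂ ∘ sat)))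
        ...   | no unsat = let f , unsat-f = ¬∀⇒∃¬ unsat in Q-unsat-absurd f eq unsat-f

      absurd : ⊥
      absurd with find head-U
      ... | disj e as , d∈ , g , Dg , Hg = Refutation.refute d∈ g Dg Hg

    -- Only rules without variables can fire in an empty I; realising the empty diagram while
    -- avoiding ∃ȳ ⊤ gives an empty member of C, which cannot satisfy such a rule.
    empty⇒⊨ : (∀ x → ¬ dom I x) → ∀ σ → σ ∈ Σ₀ → I ⊨ σ
    empty⇒⊨ empty (dexr (suc v) _ _)            _  h Dh _ = ⊥-elim (empty _ (Dh Fin.zero))
    empty⇒⊨ empty (dexr zero (atom R u ∷ _) _) _  = ⊥-elim (no-args-over-Fin0 {S} R u)
    empty⇒⊨ empty (dexr zero [] head)           σ∈ _ _ _ with some-member head (proj₁ (proj₂ wf))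
      where wf = proj₁ (All.lookup Σ₀-nml σ∈)
    ... | disj e as , d∈ with some-member as (All.lookup (proj₂ (proj₂ (proj₁ (All.lookup Σ₀-nml σ∈)))) d∈)
    ...   | atom R u , _ with lookup u (Fin.fromℕ< (ar-pos S R))
    ...     | inj₂ z = ⊥-elim (J-empty (J-nonempty (All.lookup (proj₁ (Σ₀-axiomatises J) J∈C) σ∈ (λ ()) (λ ()) [])))
      where
      nml = All.lookup Σ₀-nml σ∈
      y₀ : Fin m
      y₀ = Fin.inject≤ z (All.lookup (proj₁ (proj₂ (proj₂ nml))) d∈)
      []-length : length {A = Conj S m} ([] ∷ []) ≤ ℓ′
      []-length = ℕ.≤-trans (ℕ.*-mono-≤ (ℕ.≤-trans (nonempty d∈) (proj₂ (proj₂ (proj₂ nml))))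
                                         (ℕ.^-monoʳ-≤ (2 + n) {0} {m} z≤n))
                             (ℓ′-bound (WF⇒symbols (proj₁ nml)))
      realisation = compat ∅ (λ _ _ ()) (λ ()) (λ _ ()) ([] , z≤n , λ _ ()) ([] ∷ []) []-length
                      (([] , λ (a , Da , _) → empty _ (Da y₀)) ∷ [])
      J = proj₁ realisation
      J∈C = proj₁ (proj₂ realisation)
      J-empty : ¬ SatEx {m = m} J []
      J-empty = All.head (proj₂ (proj₂ (proj₂ realisation)))
      J-nonempty : Any (SatDisjunct J (λ ())) head → SatEx {m = m} J []
      J-nonempty sat with find sat
      ... | disj e′ as′ , d′∈ , g , Dg , Hg with some-member as′ (All.lookup (proj₂ (proj₂ (proj₁ nml))) d′∈)
      ...   | a , a∈ = let x = holds-dom J _ a (All.lookup Hg a∈) (Fin.fromℕ< (ar-pos S (Atom.sym a))) in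
                       (λ _ → _) , (λ _ → x) , []

    I⊨Σ₀ : I ⊨* Σ₀
    I⊨Σ₀ = All.tabulate λ {σ} → satisfies σ
      where
      satisfies : ∀ σ → σ ∈ Σ₀ → I ⊨ σ
      satisfies (dexr v body head) σ∈ h Dh body-h with dec (Any (SatDisjunct I h) head) | dec (∃[ d ] dom I d)
      ... | yes sat      | _              = sat
      ... | no violated  | yes (d₀ , d₀∈) = ⊥-elim (Violation.absurd body head σ∈ h Dh body-h violated d₀ d₀∈)
      ... | no _         | no empty       = empty⇒⊨ (λ x x∈ → empty (x , x∈)) _ σ∈ h Dh body-h

ℓ′-dominates : ∀ ℓ n m s a → 1 ≤ s → 1 ≤ a → ℓ * (2 + n) ^ m ≤ ℓ * s * (n + m + 1) ^ (m * a)
ℓ′-dominates ℓ n m s a 1≤s 1≤a = ℕ.*-mono-≤ (ℕ.m≤m*n ℓ s {{>-nonZero 1≤s}}) (base m)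
  where
  base : ∀ m → (2 + n) ^ m ≤ (n + m + 1) ^ (m * a)
  base zero     = ℕ.≤-refl
  base (suc m′) = begin
    (2 + n) ^ suc m′              ≤⟨ ℕ.^-monoˡ-≤ (suc m′) 2+n≤ ⟩
    suc (n + suc m′) ^ suc m′     ≤⟨ ℕ.^-monoʳ-≤ (suc (n + suc m′)) (ℕ.m≤m*n (suc m′) a {{>-nonZero 1≤a}}) ⟩
    suc (n + suc m′) ^ (suc m′ * a) ≡⟨ cong (λ b → b ^ (suc m′ * a)) (ℕ.+-comm 1 (n + suc m′)) ⟩
    (n + suc m′ + 1) ^ (suc m′ * a) ∎
    where
    open ℕ.≤-Reasoning
    2+n≤ : 2 + n ≤ suc (n + suc m′)
    2+n≤ = s≤s (subst (suc n ≤_) (sym (ℕ.+-suc n m′)) (s≤s (ℕ.m≤m+n n m′)))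

lemma10 : ExcludedMiddle 0ℓ → (S : Schema) → (C : Collection S) → ClosedUnderIso C →
    (n m ℓ : ℕ) → 1 ≤ n + m → 1 ≤ ℓ → FinAxByNML n m ℓ C →
    (FinAxByLinear C →
      LinDiagCompatible C n m (ℓ * size S * (n + m + 1) ^ (m * maxAr S))) ×
    (LinDiagCompatible C n m (ℓ * size S * (n + m + 1) ^ (m * maxAr S)) →
      FinAxByLinear C)
lemma10 em S C _ n m ℓ _ _ (Σ₀ , Σ₀-nml , Σ₀-axiomatises) = toCompatibility , fromCompatibility
  where
  ℓ′ = ℓ * size S * (n + m + 1) ^ (m * maxAr S)

  bound : 1 ≤ size S → ℓ * (2 + n) ^ m ≤ ℓ′
  bound 1≤size = ℓ′-dominates ℓ n m (size S) (maxAr S) 1≤size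
    (ℕ.≤-trans (ar-pos S R) (≤-sup (ar S) R))
    where R = Fin.fromℕ< 1≤size

  toCompatibility : FinAxByLinear C → LinDiagCompatible C n m ℓ′
  toCompatibility (ΣL , ΣL-linear , ΣL-axiomatises) I compat = proj₂ (Σ₀-axiomatises I)
    (ToCompatibility.I⊨Σ₀ em C n m ℓ Σ₀ Σ₀-nml Σ₀-axiomatises ΣL ΣL-linear ΣL-axiomatises ℓ′ bound I compat)

  fromCompatibility : LinDiagCompatible C n m ℓ′ → FinAxByLinear C
  fromCompatibility = FromCompatibility.finAxByLinear em C m Σ₀ (All.map proj₁ Σ₀-nml) Σ₀-axiomatises n ℓ′
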